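{- (i) There is a bijection between $E(S)$ and $E(\langle S^{\xi}, \xi 1, \xi^{ -1}1 \rangle)$, in which $\alpha \in E(S)$ if and only if $\xi^{ -m(\alpha,\alpha)}\alpha \in E(\langle S^{\xi}, \xi 1, \xi^{ -1}1 \rangle)$; (ii) if $\xi$ is a root of unity, $|E(\langle S^{\xi}, \xi1 \rangle)|=|E(S)|$; and (iii) if $\xi$ is not a root of unity, $E(\langle S^{\xi}, \xi1 \rangle)=E(S^{\xi})=\{\alpha \in E(S) : m(\alpha,\alpha)=0\}.$
   Context: Let $S$ be either the Motzkin monoid $\mathscr M_n$ or the Jones monoid $\mathscr J_n$. Let $K$ be a field and fix $\xi \in K^{\times}$. For $\alpha,\beta$ in $S$, $m(\alpha,\beta)$ is the number of floating components (components lying entirely within the middle interface row) formed in computing $\alpha\beta$. $S^{\xi}$ is the twisted variant of $S$: the subsemigroup generated by $S$ in the twisted semigroup algebra over $K$, with multiplication $\xi^i \alpha \circ \xi^j \beta = \xi^{i+j+m(\alpha,\beta)}\alpha \beta$. Also $\langle S^{\xi}, \xi1 \rangle =\{\xi^{i}\alpha : i \in \mathbb{N},\ \alpha \in S \}$ and $\langle S^{\xi}, \xi 1, \xi^{ -1}1 \rangle = \{\xi^{i}\alpha : i \in \mathbb{Z},\ \alpha \in S \}$. $E(X)$ denotes the set of idempotents in $X$. -}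

module Defs where

open import Level using (Level; _⊔_)
open import Data.Nat as ℕ using (ℕ; zero; suc; _<_; _⊓_)
open import Data.Integer as ℤ using (ℤ; +_; -[1+_])
open import Data.Fin as Fin using (Fin; splitAt; _↑ˡ_; _↑ʳ_; toℕ; opposite)
open import Data.Fin.Properties using () renaming (_≟_ to _≟F_)
open import Data.Vec as Vec using (Vec; lookup; tabulate)
open import Data.List as List using (List; []; _∷_; allFin; filter; head; length; foldr)
open import Data.Maybe using (Maybe; just; nothing)
open import Data.Product using (Σ; ∃; _×_; _,_; proj₁; proj₂)
open import Data.Sum using (_⊎_; inj₁; inj₂)
open import Relation.Nullary using (¬_)
open import Relation.Nullary.Decidable using (¬?; _×-dec_)
open import Relation.Binary.PropositionalEquality using (_≡_; _≢_; refl; sym; trans)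
import Relation.Binary.PropositionalEquality as P
open import Relation.Binary.Bundles using (Setoid)
open import Relation.Binary.Structures using (IsEquivalence)
open import Algebra.Bundles using (CommutativeRing)

-- A diagram is stored as a table indexed by the 2n vertices
--   i ↑ˡ n  = top vertex i,   n ↑ʳ i = bottom vertex i   (i : Fin n)
-- giving for each vertex its partner (just w) if it lies in a block of
-- size 2, or nothing if it is a singleton block.

record Table (n : ℕ) : Set where
  constructor mkTable
  field
    tab : Vec (Maybe (Fin (n ℕ.+ n))) (n ℕ.+ n)

_⟨_⟩ : ∀ {n} → Table n → Fin (n ℕ.+ n) → Maybe (Fin (n ℕ.+ n))
t ⟨ u ⟩ = lookup (Table.tab t) u

-- position of a vertex on the boundary of the rectangle, read cyclically:
-- top 1..n from left to right, then bottom n..1 from right to left.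
pos : ∀ n → Fin (n ℕ.+ n) → ℕ
pos n k with splitAt n k
... | inj₁ i = toℕ i
... | inj₂ i = n ℕ.+ toℕ (opposite i)

record IsMotzkin {n : ℕ} (t : Table n) : Set where
  field
    irrefl   : ∀ u → t ⟨ u ⟩ ≢ just u
    symmetric : ∀ u v → t ⟨ u ⟩ ≡ just v → t ⟨ v ⟩ ≡ just u
    planar   : ∀ a b c d → t ⟨ a ⟩ ≡ just b → t ⟨ c ⟩ ≡ just d →
               ¬ (pos n a < pos n c × pos n c < pos n b × pos n b < pos n d)

record IsJones {n : ℕ} (t : Table n) : Set where
  field
    motzkin : IsMotzkin t
    total   : ∀ u → ∃ λ v → t ⟨ u ⟩ ≡ just v

data Kind : Set where
  motzkin jones : Kind

InS : Kind → ∀ {n} → Table n → Set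
InS motzkin t = IsMotzkin t
InS jones   t = IsJones t

-- The product graph of α (on top) and β (below): vertices are the top
-- row of α (T), the middle interface row (M) and the bottom row of β (B).

data PV (n : ℕ) : Set where
  T M B : Fin n → PV n

idx : ∀ {n} → PV n → ℕ
idx     (T i) = toℕ i
idx {n} (B i) = n ℕ.+ toℕ i
idx {n} (M i) = n ℕ.+ n ℕ.+ toℕ i

module Product {n : ℕ} (α β : Table n) where

  embα : Fin (n ℕ.+ n) → PV n
  embα k with splitAt n k
  ... | inj₁ i = T i
  ... | inj₂ i = M i

  embβ : Fin (n ℕ.+ n) → PV n
  embβ k with splitAt n k
  ... | inj₁ i = M i
  ... | inj₂ i = B i

  toList : {A : Set} → Maybe A → List A
  toList nothing  = []
  toList (just x) = x ∷ []

  nbrs : PV n → List (PV n)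
  nbrs (T i) = List.map embα (toList (α ⟨ (i ↑ˡ n) ⟩))
  nbrs (M i) = List.map embα (toList (α ⟨ (n ↑ʳ i) ⟩))
               List.++ List.map embβ (toList (β ⟨ (i ↑ˡ n) ⟩))
  nbrs (B i) = List.map embβ (toList (β ⟨ (n ↑ʳ i) ⟩))

  -- label propagation: after k rounds, each vertex carries the minimal
  -- idx over all vertices at distance ≤ k.  Since the graph has 3n
  -- vertices, 3n rounds give the minimal idx of the connected component.
  step : (PV n → ℕ) → PV n → ℕ
  step L v = foldr (λ w r → L w ⊓ r) (L v) (nbrs v)

  iter : ℕ → (PV n → ℕ) → PV n → ℕ
  iter zero    L = L
  iter (suc k) L = step (iter k L)

  comp : PV n → ℕ
  comp = iter (n ℕ.+ n ℕ.+ n) idx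

  outer : Fin (n ℕ.+ n) → PV n
  outer k with splitAt n k
  ... | inj₁ i = T i
  ... | inj₂ i = B i

  -- the product αβ: u is joined to the other outer vertex in its component
  prod : Table n
  prod = mkTable (tabulate λ u →
    head (filter (λ v → ¬? (v ≟F u) ×-dec (comp (outer v) ℕ.≟ comp (outer u)))
                 (allFin (n ℕ.+ n))))

  -- number of floating components: components contained in the middle
  -- row; each is counted once, at its vertex of minimal idx (a component
  -- meeting the top/bottom row has minimal idx < 2n ≤ idx of any M i).
  floating : ℕ
  floating = length (filter (λ i → comp (M i) ℕ.≟ idx (M i)) (allFin n))

_·_ : ∀ {n} → Table n → Table n → Table n
α · β = Product.prod α β

m : ∀ {n} → Table n → Table n → ℕ
m α β = Product.floating α β

record IsField {c ℓ : Level} (K : CommutativeRing c ℓ) : Set (c ⊔ ℓ) where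
  open CommutativeRing K using (Carrier; _≈_; _*_; 1#; 0#)
  field
    nontrivial : ¬ (1# ≈ 0#)
    inverse    : ∀ x → ¬ (x ≈ 0#) → ∃ λ y → x * y ≈ 1#

module Twisted {c ℓ : Level} (K : CommutativeRing c ℓ)
               (ξ ξ⁻¹ : CommutativeRing.Carrier K) where
  open CommutativeRing K using (Carrier; _≈_; _*_; 1#; 0#)

  _^_ : Carrier → ℕ → Carrier
  x ^ zero  = 1#
  x ^ suc k = x * (x ^ k)

  pw : ℤ → Carrier
  pw (+ k)     = ξ ^ k
  pw -[1+ k ]  = ξ⁻¹ ^ suc k

  IsRootOfUnity : Set ℓ
  IsRootOfUnity = Σ ℕ λ r → (0 < r) × (ξ ^ r ≈ 1#)

  -- the element ξ^i α of the twisted semigroup algebra is represented by (i , α)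
  Elem : ℕ → Set
  Elem n = ℤ × Table n

  _≋_ : ∀ {n} → Elem n → Elem n → Set ℓ
  x ≋ y = (proj₂ x ≡ proj₂ y) × (pw (proj₁ x) ≈ pw (proj₁ y))

  ≋-refl : ∀ {n} (x : Elem n) → x ≋ x
  ≋-refl x = refl , CommutativeRing.refl K

  ≋-sym : ∀ {n} (x y : Elem n) → x ≋ y → y ≋ x
  ≋-sym x y (p , q) = sym p , CommutativeRing.sym K q

  ≋-trans : ∀ {n} (x y z : Elem n) → x ≋ y → y ≋ z → x ≋ z
  ≋-trans x y z (p , q) (p' , q') = trans p p' , CommutativeRing.trans K q q'

  _∘_ : ∀ {n} → Elem n → Elem n → Elem n
  (i , α) ∘ (j , β) = (i ℤ.+ j ℤ.+ + m α β , α · β)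

  IsIdem : ∀ {n} → Elem n → Set ℓ
  IsIdem x = (x ∘ x) ≋ x

  module _ (k : Kind) {n : ℕ} where

    InES : Table n → Set
    InES α = InS k α × (α · α ≡ α)

    -- ⟨S^ξ, ξ1, ξ⁻¹1⟩ = { ξ^i α : i ∈ ℤ, α ∈ S }
    InZ : Elem n → Set
    InZ x = InS k (proj₂ x)

    -- ⟨S^ξ, ξ1⟩ = { ξ^i α : i ∈ ℕ, α ∈ S }
    InN : Elem n → Set ℓ
    InN x = InS k (proj₂ x) × (Σ ℕ λ i → x ≋ (+ i , proj₂ x))

    data Gen : Elem n → Set where
      gen : ∀ α → InS k α → Gen (+ 0 , α)
      mul : ∀ {x y} → Gen x → Gen y → Gen (x ∘ y)

    InSξ : Elem n → Set ℓ
    InSξ x = Σ (Elem n) λ y → Gen y × (y ≋ x)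

    InEZ : Elem n → Set ℓ
    InEZ x = InZ x × IsIdem x

    InEN : Elem n → Set ℓ
    InEN x = InN x × IsIdem x

    InESξ : Elem n → Set ℓ
    InESξ x = InSξ x × IsIdem x

    -- E(S) and E(⟨S^ξ, ξ1⟩) as setoids (for comparing cardinalities)
    ES-setoid : Setoid _ _
    ES-setoid = record
      { Carrier = Σ (Table n) InES
      ; _≈_ = λ a b → proj₁ a ≡ proj₁ b
      ; isEquivalence = record { refl = refl ; sym = sym ; trans = trans } }

    ENCarrier : Set ℓ
    ENCarrier = Σ (Elem n) InEN

    _≈EN_ : ENCarrier → ENCarrier → Set ℓ
    a ≈EN b = proj₁ a ≋ proj₁ b

    ≈EN-isEquivalence : IsEquivalence _≈EN_
    ≈EN-isEquivalence = record
      { refl  = λ {a} → ≋-refl (proj₁ a)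
      ; sym   = λ {a} {b} → ≋-sym (proj₁ a) (proj₁ b)
      ; trans = λ {a} {b} {d} → ≋-trans (proj₁ a) (proj₁ b) (proj₁ d) }

    EN-setoid : Setoid ℓ ℓ
    EN-setoid = record
      { Carrier = ENCarrier ; _≈_ = _≈EN_ ; isEquivalence = ≈EN-isEquivalence }

module Submission where

-- Since (i , α) ∘ (i , α) = (2i + m(α,α) , αα) and powers of ξ are
-- invertible, ξ^i α is idempotent iff α ∈ E(S) and ξ^i = ξ^(-m(α,α))
-- (TwistedVariant.idempotent⇔).  This gives (i); for (ii) a root of unity
-- ξ^r = 1 lets us replace -m(α,α) by the natural exponent (r-1)m(α,α); for
-- (iii), ξ^(j + m(α,α)) = 1 with j ∈ ℕ forces j = m(α,α) = 0.
--
-- Part (iii) also needs S^ξ ⊆ {ξ^j α : j ∈ ℕ, α ∈ S}, i.e. that the product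
-- of Defs (label propagation on the product graph) maps S × S into S; this
-- `closure` is the bulk of the file.  The product graph has maximum degree 2
-- and its labels are its components; a component has at most two vertices of
-- degree ≤ 1, so αβ is a partial matching; planarity follows from a parity
-- (discrete Jordan curve) lemma for noncrossing matchings; for Jones diagrams,
-- totality follows from the handshake lemma.

open import Defs
open import Level using (0ℓ)
open import Data.Bool using (Bool; true; false; _∧_; _xor_)
open import Data.Bool.Properties
  using (xor-identityʳ; ∧-zeroʳ; ∧-identityʳ; ∧-assoc; T-≡; ¬-not; xor-∧-commutativeRing)
open import Data.Nat as ℕ using (ℕ; zero; suc; _<_; _≤_; _<?_; _+_; _∸_; _⊓_; z≤n; s≤s; _<ᵇ_; _≡ᵇ_)
open import Data.Nat.Properties hiding (*-assoc; *-comm; *-identityˡ; *-identityʳ; *-commutativeSemigroup)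
open import Data.Integer as ℤ using (ℤ; +_; -[1+_]; -_; _⊖_)
import Data.Integer.Properties as ℤP
open import Data.Fin as Fin using (Fin; splitAt; _↑ˡ_; _↑ʳ_; toℕ; opposite; fromℕ<; join)
open import Data.Fin.Properties
  using (splitAt-↑ˡ; splitAt-↑ʳ; join-splitAt; toℕ-injective; opposite-prop; opposite-involutive;
         toℕ<n; toℕ-fromℕ<)
  renaming (_≟_ to _≟F_)
open import Data.Maybe as Maybe using (Maybe; just; nothing; is-just)
open import Data.Maybe.Properties using (just-injective)
open import Data.List as List using (List; []; _∷_; _++_; foldr; length; filter; head; allFin)
open import Data.List.Properties using (length-map; ++-identityʳ)
open import Data.List.Membership.Propositional using (_∈_)
open import Data.List.Membership.Propositional.Properties using (∈-allFin)
open import Data.List.Relation.Unary.Any using (here; there)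
open import Data.List.Relation.Unary.Any.Properties using (++⁻; ++⁺ˡ; ++⁺ʳ)
open import Data.List.Relation.Unary.All using (All; []; _∷_)
open import Data.List.Relation.Unary.AllPairs using ([]; _∷_)
open import Data.List.Relation.Unary.Unique.Propositional using (Unique)
import Data.List.Relation.Unary.Unique.Propositional.Properties as Unique
open import Data.Vec.Properties using (lookup∘tabulate)
open import Data.Product using (Σ; ∃; ∃₂; _×_; _,_; proj₁; proj₂)
open import Data.Sum using (_⊎_; inj₁; inj₂)
open import Data.Empty using (⊥; ⊥-elim)
open import Relation.Nullary using (¬_; yes; no; Dec)
open import Relation.Nullary.Decidable using (¬?; _×-dec_)
open import Relation.Unary using (Pred; Decidable)
open import Relation.Binary using (tri<; tri≈; tri>)
open import Relation.Binary.PropositionalEquality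
  using (_≡_; _≢_; refl; sym; trans; cong; cong₂; subst; module ≡-Reasoning)
open import Function.Bundles using (_⇔_; mk⇔; Bijection; Equivalence)
open import Algebra.Bundles using (CommutativeRing)
import Algebra.Properties.CommutativeSemigroup as CommSemigroupProperties

-- Parity sums.  `parity f t` is the parity of #{p < t : f p}; boolean
-- comparisons are used so that parities can be computed by rewriting.

module ParitySums where

  parity : (ℕ → Bool) → ℕ → Bool
  parity f zero = false
  parity f (suc t) = parity f t xor f t

  lt : ℕ → ℕ → Bool
  lt p q = p <ᵇ q

  eqb : ℕ → ℕ → Bool
  eqb p q = p ≡ᵇ q

  lt-true : ∀ {p q} → lt p q ≡ true → p < q
  lt-true {p} {q} e = <ᵇ⇒< p q (Equivalence.from T-≡ e)

  lt-yes : ∀ {p q} → p < q → lt p q ≡ true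
  lt-yes p<q = Equivalence.to T-≡ (<⇒<ᵇ p<q)

  lt-no : ∀ {p q} → ¬ p < q → lt p q ≡ false
  lt-no p≮q = ¬-not (λ e → p≮q (lt-true e))

  eqb-true : ∀ {p q} → eqb p q ≡ true → p ≡ q
  eqb-true {p} {q} e = ≡ᵇ⇒≡ p q (Equivalence.from T-≡ e)

  eqb-yes : ∀ {p q} → p ≡ q → eqb p q ≡ true
  eqb-yes {p} {q} p≡q = Equivalence.to T-≡ (≡⇒≡ᵇ p q p≡q)

  eqb-no : ∀ {p q} → p ≢ q → eqb p q ≡ false
  eqb-no p≢q = ¬-not (λ e → p≢q (eqb-true e))

  eqb-sym : ∀ p q → eqb p q ≡ eqb q p
  eqb-sym p q with p ≟ q
  ... | yes refl = refl
  ... | no p≢q = trans (eqb-no p≢q) (sym (eqb-no (λ e → p≢q (sym e))))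

  xor-interchange : ∀ a b c d → (a xor b) xor (c xor d) ≡ (a xor c) xor (b xor d)
  xor-interchange = CommSemigroupProperties.interchange
    (CommutativeRing.+-commutativeSemigroup xor-∧-commutativeRing)

  parity-cong : ∀ {f g} t → (∀ p → p < t → f p ≡ g p) → parity f t ≡ parity g t
  parity-cong zero h = refl
  parity-cong (suc t) h =
    cong₂ _xor_ (parity-cong t (λ p p<t → h p (m<n⇒m<1+n p<t))) (h t ≤-refl)

  parity-xor : ∀ f g t → parity (λ p → f p xor g p) t ≡ parity f t xor parity g t
  parity-xor f g zero = refl
  parity-xor f g (suc t) rewrite parity-xor f g t =
    xor-interchange (parity f t) (parity g t) (f t) (g t)

  parity-false : ∀ {f} t → (∀ p → p < t → f p ≡ false) → parity f t ≡ false
  parity-false zero h = refl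
  parity-false (suc t) h
    rewrite parity-false t (λ p p<t → h p (m<n⇒m<1+n p<t)) | h t ≤-refl = refl

  parity-point : ∀ (c : ℕ → Bool) q t → parity (λ p → c p ∧ eqb q p) t ≡ c q ∧ lt q t
  parity-point c q zero = sym (∧-zeroʳ (c q))
  parity-point c q (suc t) rewrite parity-point c q t with q ≟ t
  ... | yes refl rewrite eqb-yes {q} refl | lt-no (<-irrefl {q} refl) | lt-yes (n<1+n q)
                       | ∧-zeroʳ (c q) with c q
  ...   | true = refl
  ...   | false = refl
  parity-point c q (suc t) | no q≢t
    rewrite eqb-no q≢t | ∧-zeroʳ (c t) | xor-identityʳ (c q ∧ lt q t) with q <? t
  ... | yes q<t rewrite lt-yes q<t | lt-yes (m<n⇒m<1+n q<t) = refl
  ... | no q≮t rewrite lt-no q≮t | lt-no (λ q<1+t → q≮t (≤∧≢⇒< (≤-pred q<1+t) q≢t)) = refl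

  parity-true : ∀ f t → parity f t ≡ true → ∃ λ p → p < t × f p ≡ true
  parity-true f zero ()
  parity-true f (suc t) h with parity f t in e1 | f t in e2
  ... | true | _ = let (p , p<t , fp) = parity-true f t e1 in p , m<n⇒m<1+n p<t , fp
  ... | false | true = t , ≤-refl , e2
  parity-true f (suc t) () | false | false

  parity-skip : ∀ f t k → (∀ p → t ≤ p → p < t + k → f p ≡ false) → parity f (t + k) ≡ parity f t
  parity-skip f t zero h rewrite +-identityʳ t = refl
  parity-skip f t (suc k) h rewrite +-suc t k
    | parity-skip f t k (λ p t≤p p<t+k → h p t≤p (m<n⇒m<1+n p<t+k))
    | h (t + k) (m≤m+n t k) (n<1+n _) = xor-identityʳ _

-- The parity lemma for noncrossing matchings (a discrete Jordan curve
-- theorem).  Let pa be a noncrossing partial matching of {0,…,N-1} and P a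
-- set of points closed under pa.  For a cut just before position t, the
-- number of P-arcs passing over the cut has the parity of the number of
-- matched P-points before t; and the crossing count is the same at both
-- ends of an arc outside P, since such an arc is crossed by no P-arc.

module NoncrossingParity (N : ℕ) (pa : ℕ → Maybe ℕ) (inP : ℕ → Bool)
  (pa-sym : ∀ p q → pa p ≡ just q → pa q ≡ just p)
  (pa-irrefl : ∀ p → pa p ≢ just p)
  (pa-bound : ∀ p q → pa p ≡ just q → q < N)
  (inP-closed : ∀ p q → pa p ≡ just q → inP p ≡ inP q)
  (pa-noncrossing : ∀ p q r s → pa p ≡ just q → pa r ≡ just s → ¬ (p < r × r < q × q < s))
  where
  open ParitySums

  t≤partner t<partner partner≡ : ℕ → Maybe ℕ → Bool
  t≤partner t (just q) = lt t (suc q)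
  t≤partner t nothing = false
  t<partner t (just q) = lt t q
  t<partner t nothing = false
  partner≡ t (just q) = eqb q t
  partner≡ t nothing = false

  covers : ℕ → ℕ → Bool
  covers t p = inP p ∧ (lt p t ∧ t≤partner t (pa p))

  crossings : ℕ → Bool
  crossings t = parity (covers t) N

  matched : ℕ → Bool
  matched p = inP p ∧ is-just (pa p)

  endsAt startsAt : ℕ → ℕ → Bool
  endsAt t p = inP p ∧ (lt p t ∧ partner≡ t (pa p))
  startsAt t p = inP p ∧ (eqb p t ∧ t<partner t (pa p))

  covers-arith : ∀ p q t → (lt p (suc t) ∧ lt t q)
               ≡ (lt p t ∧ lt t (suc q)) xor ((lt p t ∧ eqb q t) xor (eqb p t ∧ lt t q))
  covers-arith p q t with <-cmp p t | <-cmp q t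
  ... | tri< p<t _ _ | tri< q<t _ _
    rewrite lt-yes (m<n⇒m<1+n p<t) | lt-yes p<t | lt-no (<-asym q<t)
          | lt-no (λ h → <-asym q<t (≤∧≢⇒< (≤-pred h) (λ e → <-irrefl (sym e) q<t)))
          | eqb-no (<⇒≢ q<t) | eqb-no (<⇒≢ p<t) = refl
  ... | tri< p<t _ _ | tri≈ _ refl _
    rewrite lt-yes (m<n⇒m<1+n p<t) | lt-yes p<t | lt-no (<-irrefl {q} refl) | lt-yes (n<1+n q)
          | eqb-yes {q} refl | eqb-no (<⇒≢ p<t) = refl
  ... | tri< p<t _ _ | tri> _ _ t<q
    rewrite lt-yes (m<n⇒m<1+n p<t) | lt-yes p<t | lt-yes t<q | lt-yes (m<n⇒m<1+n t<q)
          | eqb-no (λ e → <-irrefl (sym e) t<q) | eqb-no (<⇒≢ p<t) = refl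
  ... | tri≈ _ refl _ | tri< q<t _ _
    rewrite lt-yes (n<1+n p) | lt-no (<-irrefl {p} refl) | lt-no (<-asym q<t) | eqb-yes {p} refl = refl
  ... | tri≈ _ refl _ | tri≈ _ refl _
    rewrite lt-yes (n<1+n p) | lt-no (<-irrefl {p} refl) | eqb-yes {p} refl = refl
  ... | tri≈ _ refl _ | tri> _ _ t<q
    rewrite lt-yes (n<1+n p) | lt-no (<-irrefl {p} refl) | lt-yes t<q | eqb-yes {p} refl = refl
  ... | tri> _ _ t<p | tri< q<t _ _
    rewrite lt-no (λ h → <-irrefl refl (≤-<-trans (≤-pred h) t<p)) | lt-no (<-asym t<p)
          | eqb-no (λ e → <-irrefl (sym e) t<p) = refl
  ... | tri> _ _ t<p | tri≈ _ refl _
    rewrite lt-no (λ h → <-irrefl refl (≤-<-trans (≤-pred h) t<p)) | lt-no (<-asym t<p)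
          | eqb-no (λ e → <-irrefl (sym e) t<p) = refl
  ... | tri> _ _ t<p | tri> _ _ t<q
    rewrite lt-no (λ h → <-irrefl refl (≤-<-trans (≤-pred h) t<p)) | lt-no (<-asym t<p)
          | eqb-no (λ e → <-irrefl (sym e) t<p) = refl

  covers-suc : ∀ t p → covers (suc t) p ≡ covers t p xor (endsAt t p xor startsAt t p)
  covers-suc t p with pa p | inP p
  ... | nothing | true
    rewrite ∧-zeroʳ (lt p (suc t)) | ∧-zeroʳ (lt p t) | ∧-zeroʳ (eqb p t) = refl
  ... | nothing | false = refl
  ... | just q | true = covers-arith p q t
  ... | just q | false = refl

  endsAt-at-partner : Maybe ℕ → ℕ → ℕ → Bool
  endsAt-at-partner (just q) t p = (inP t ∧ lt p t) ∧ eqb q p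
  endsAt-at-partner nothing t p = false

  endsAt-pointwise : ∀ t p → endsAt t p ≡ endsAt-at-partner (pa t) t p
  endsAt-pointwise t p with pa t in et | pa p in ep
  ... | nothing | nothing rewrite ∧-zeroʳ (lt p t) | ∧-zeroʳ (inP p) = refl
  ... | nothing | just r with r ≟ t
  ...   | yes refl with trans (sym (pa-sym p t ep)) et
  ...     | ()
  endsAt-pointwise t p | nothing | just r | no r≢t
    rewrite eqb-no r≢t | ∧-zeroʳ (lt p t) | ∧-zeroʳ (inP p) = refl
  endsAt-pointwise t p | just q | nothing with q ≟ p
  ... | yes refl with trans (sym (pa-sym t q et)) ep
  ...   | ()
  endsAt-pointwise t p | just q | nothing | no q≢p
    rewrite eqb-no q≢p | ∧-zeroʳ (lt p t) | ∧-zeroʳ (inP p) | ∧-zeroʳ (inP t ∧ lt p t) = refl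
  endsAt-pointwise t p | just q | just r with r ≟ t
  ... | yes refl rewrite just-injective (trans (sym et) (pa-sym p r ep)) | eqb-yes {r} refl
                       | eqb-yes {p} refl | inP-closed p r ep | ∧-assoc (inP r) (lt p r) true = refl
  ... | no r≢t with q ≟ p
  ...   | yes refl with r≢t (just-injective (trans (sym ep) (pa-sym t q et)))
  ...     | ()
  endsAt-pointwise t p | just q | just r | no r≢t | no q≢p
    rewrite eqb-no r≢t | eqb-no q≢p | ∧-zeroʳ (lt p t) | ∧-zeroʳ (inP p)
          | ∧-zeroʳ (inP t ∧ lt p t) = refl

  endsBefore : Maybe ℕ → ℕ → Bool
  endsBefore (just q) t = inP t ∧ lt q t
  endsBefore nothing t = false

  endsAt-sum : ∀ t → parity (endsAt t) N ≡ endsBefore (pa t) t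
  endsAt-sum t = trans (parity-cong N (λ p _ → endsAt-pointwise t p)) (sum (pa t) refl)
    where
    sum : ∀ r → pa t ≡ r → parity (endsAt-at-partner r t) N ≡ endsBefore r t
    sum nothing e = parity-false N (λ _ _ → refl)
    sum (just q) e rewrite parity-point (λ p → inP t ∧ lt p t) q N | lt-yes (pa-bound t q e) =
      ∧-identityʳ _

  startsAt-pointwise : ∀ t p → startsAt t p ≡ (inP p ∧ t<partner t (pa p)) ∧ eqb t p
  startsAt-pointwise t p rewrite eqb-sym t p with inP p | eqb p t | t<partner t (pa p)
  ... | true | true | true = refl
  ... | true | true | false = refl
  ... | true | false | true = refl
  ... | true | false | false = refl
  ... | false | _ | _ = refl

  startsAt-sum : ∀ t → parity (startsAt t) N ≡ (inP t ∧ t<partner t (pa t)) ∧ lt t N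
  startsAt-sum t = trans (parity-cong N (λ p _ → startsAt-pointwise t p))
                         (parity-point (λ p → inP p ∧ t<partner t (pa p)) t N)

  ends-or-starts : ∀ t → endsBefore (pa t) t xor ((inP t ∧ t<partner t (pa t)) ∧ lt t N) ≡ matched t
  ends-or-starts t = go (pa t) refl
    where
    go : ∀ r → pa t ≡ r → endsBefore r t xor ((inP t ∧ t<partner t r) ∧ lt t N) ≡ inP t ∧ is-just r
    go nothing e rewrite ∧-zeroʳ (inP t) = refl
    go (just q) e rewrite lt-yes (pa-bound q t (pa-sym t q e)) | ∧-identityʳ (inP t ∧ lt t q)
      with <-cmp q t
    ... | tri< q<t _ _ rewrite lt-yes q<t | lt-no (<-asym q<t) | ∧-zeroʳ (inP t) | ∧-identityʳ (inP t) =
      xor-identityʳ _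
    ... | tri≈ _ refl _ = ⊥-elim (pa-irrefl q e)
    ... | tri> _ _ t<q rewrite lt-no (<-asym t<q) | lt-yes t<q | ∧-zeroʳ (inP t) | ∧-identityʳ (inP t) =
      refl

  crossings-suc : ∀ t → crossings (suc t) ≡ crossings t xor matched t
  crossings-suc t = begin
      parity (covers (suc t)) N
    ≡⟨ parity-cong N (λ p _ → covers-suc t p) ⟩
      parity (λ p → covers t p xor (endsAt t p xor startsAt t p)) N
    ≡⟨ parity-xor (covers t) (λ p → endsAt t p xor startsAt t p) N ⟩
      crossings t xor parity (λ p → endsAt t p xor startsAt t p) N
    ≡⟨ cong (crossings t xor_) (parity-xor (endsAt t) (startsAt t) N) ⟩
      crossings t xor (parity (endsAt t) N xor parity (startsAt t) N)
    ≡⟨ cong (crossings t xor_) (cong₂ _xor_ (endsAt-sum t) (startsAt-sum t)) ⟩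
      crossings t xor (endsBefore (pa t) t xor ((inP t ∧ t<partner t (pa t)) ∧ lt t N))
    ≡⟨ cong (crossings t xor_) (ends-or-starts t) ⟩
      crossings t xor matched t ∎
    where open ≡-Reasoning

  crossings≡matched-before : ∀ t → crossings t ≡ parity matched t
  crossings≡matched-before zero = parity-false N (λ p _ → none p)
    where
    none : ∀ p → covers 0 p ≡ false
    none p rewrite lt-no {p} {0} (λ ()) = ∧-zeroʳ (inP p)
  crossings≡matched-before (suc t) rewrite crossings-suc t | crossings≡matched-before t = refl

  crossings-beyond : ∀ t → (∀ p q → pa p ≡ just q → q < t) → crossings t ≡ false
  crossings-beyond t h = parity-false N (λ p _ → none p (pa p) refl)
    where
    none : ∀ p r → pa p ≡ r → covers t p ≡ false
    none p nothing e rewrite e = trans (cong (inP p ∧_) (∧-zeroʳ (lt p t))) (∧-zeroʳ (inP p))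
    none p (just q) e rewrite e | lt-no {t} {suc q} (λ t≤q → <-irrefl refl (<-≤-trans (h p q e) (≤-pred t≤q))) =
      trans (cong (inP p ∧_) (∧-zeroʳ (lt p t))) (∧-zeroʳ (inP p))

  nested : ∀ p q x y → pa p ≡ just q → pa x ≡ just y → p ≢ y → q ≢ y →
           p < x → x < q → p < y × y < q
  nested p q x y epq exy p≢y q≢y p<x x<q with <-cmp y p | <-cmp y q
  ... | tri< y<p _ _ | _ = ⊥-elim (pa-noncrossing y x p q (pa-sym x y exy) epq (y<p , p<x , x<q))
  ... | tri≈ _ e _ | _ = ⊥-elim (p≢y (sym e))
  ... | tri> _ _ p<y | tri< y<q _ _ = p<y , y<q
  ... | tri> _ _ p<y | tri≈ _ e _ = ⊥-elim (q≢y (sym e))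
  ... | tri> _ _ p<y | tri> _ _ q<y = ⊥-elim (pa-noncrossing p q x y epq exy (p<x , x<q , q<y))

  ∧-true : ∀ {a b} → a ∧ b ≡ true → a ≡ true × b ≡ true
  ∧-true {true} {true} e = refl , refl

  P-vs-notP : ∀ {p x} → inP p ≡ true → inP x ≡ false → p ≢ x
  P-vs-notP ep ex refl with trans (sym ep) ex
  ... | ()

  same-membership : ∀ {x y b} → pa x ≡ just y → inP x ≡ b → inP y ≡ b
  same-membership {x} {y} exy ex = trans (sym (inP-closed x y exy)) ex

  arc-outside-stays : ∀ {p q} x y → inP p ≡ true → pa p ≡ just q → pa x ≡ just y → inP x ≡ false →
                      lt p x ∧ lt x (suc q) ≡ true → lt p y ∧ lt y (suc q) ≡ true
  arc-outside-stays {p} {q} x y ip epq exy ix e with ∧-true e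
  ... | (p<x , x≤q)
    with nested p q x y epq exy (P-vs-notP ip (same-membership exy ix))
                (P-vs-notP (same-membership epq ip) (same-membership exy ix)) (lt-true p<x)
                (≤∧≢⇒< (≤-pred (lt-true x≤q)) (λ e → P-vs-notP (same-membership epq ip) ix (sym e)))
  ... | (p<y , y<q) rewrite lt-yes p<y | lt-yes (m<n⇒m<1+n y<q) = refl

  covers-arc-outside : ∀ x y p → pa x ≡ just y → inP x ≡ false → covers x p ≡ covers y p
  covers-arc-outside x y p exy ix with inP p in ip | pa p in ep
  ... | false | _ = refl
  ... | true | nothing = trans (∧-zeroʳ (lt p x)) (sym (∧-zeroʳ (lt p y)))
  ... | true | just q with lt p x ∧ lt x (suc q) in e1 | lt p y ∧ lt y (suc q) in e2
  ...   | true | true = refl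
  ...   | false | false = refl
  ...   | true | false with trans (sym (arc-outside-stays x y ip ep exy ix e1)) e2
  ...     | ()
  covers-arc-outside x y p exy ix | true | just q | false | true
    with trans (sym (arc-outside-stays y x ip ep (pa-sym x y exy) (same-membership exy ix) e2)) e1
  ...     | ()

  crossings-arc-outside : ∀ x y → pa x ≡ just y → inP x ≡ false → crossings x ≡ crossings y
  crossings-arc-outside x y exy ix = parity-cong N (λ p _ → covers-arc-outside x y p exy ix)

split-view : ∀ {n} (k : Fin (n + n)) → (∃ λ i → k ≡ i ↑ˡ n) ⊎ (∃ λ i → k ≡ n ↑ʳ i)
split-view {n} k with splitAt n k in e
... | inj₁ i = inj₁ (i , trans (sym (join-splitAt n n k)) (cong (join n n) e))
... | inj₂ i = inj₂ (i , trans (sym (join-splitAt n n k)) (cong (join n n) e))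

map-just : ∀ {A B : Set} {f : A → B} {r y} → Maybe.map f r ≡ just y → ∃ λ x → r ≡ just x × f x ≡ y
map-just {r = just x} refl = x , refl , refl

is-just-map : ∀ {A C : Set} (f : A → C) m → is-just (Maybe.map f m) ≡ is-just m
is-just-map f nothing = refl
is-just-map f (just x) = refl

rev : ∀ {n} → Fin n → ℕ
rev i = toℕ (opposite i)

rev-sum : ∀ {n} (i : Fin n) → suc (rev i + toℕ i) ≡ n
rev-sum {n} i = trans (sym (+-suc (rev i) (toℕ i)))
                      (trans (cong (_+ suc (toℕ i)) (opposite-prop i)) (m∸n+n≡m (toℕ<n i)))

rev<n : ∀ {n} (i : Fin n) → rev i < n
rev<n i = toℕ<n (opposite i)

rev-inj : ∀ {n} {i j : Fin n} → rev i ≡ rev j → i ≡ j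
rev-inj {n} {i} {j} e =
  trans (sym (opposite-involutive i)) (trans (cong opposite (toℕ-injective e)) (opposite-involutive j))

sum-flip : ∀ {X x Y y} → X + x ≡ Y + y → X < Y → y < x
sum-flip {X} {x} {Y} {y} e X<Y with y <? x
... | yes h = h
... | no h = ⊥-elim (<-irrefl e (+-mono-<-≤ X<Y (≮⇒≥ h)))

rev-antitone : ∀ {n} {i j : Fin n} → toℕ j < toℕ i → rev i < rev j
rev-antitone {n} {i} {j} h =
  sum-flip (trans (+-comm (toℕ j) (rev j))
                  (trans (suc-injective (trans (rev-sum j) (sym (rev-sum i)))) (+-comm (rev i) (toℕ i)))) h

module ProductGraph {n : ℕ} (α β : Table n) where
  open Product α β using (embα; embβ; nbrs; toList)

  V : Set
  V = PV n

  _≟V_ : (v w : V) → Dec (v ≡ w)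
  T i ≟V T j with i ≟F j
  ... | yes refl = yes refl
  ... | no ne = no (λ { refl → ne refl })
  M i ≟V M j with i ≟F j
  ... | yes refl = yes refl
  ... | no ne = no (λ { refl → ne refl })
  B i ≟V B j with i ≟F j
  ... | yes refl = yes refl
  ... | no ne = no (λ { refl → ne refl })
  T i ≟V M j = no (λ ())
  T i ≟V B j = no (λ ())
  M i ≟V T j = no (λ ())
  M i ≟V B j = no (λ ())
  B i ≟V T j = no (λ ())
  B i ≟V M j = no (λ ())

  embα-L : ∀ i → embα (i ↑ˡ n) ≡ T i
  embα-L i rewrite splitAt-↑ˡ n i n = refl
  embα-R : ∀ i → embα (n ↑ʳ i) ≡ M i
  embα-R i rewrite splitAt-↑ʳ n n i = refl
  embβ-L : ∀ i → embβ (i ↑ˡ n) ≡ M i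
  embβ-L i rewrite splitAt-↑ˡ n i n = refl
  embβ-R : ∀ i → embβ (n ↑ʳ i) ≡ B i
  embβ-R i rewrite splitAt-↑ʳ n n i = refl

  αnb βnb : V → Maybe V
  αnb (T i) = Maybe.map embα (α ⟨ i ↑ˡ n ⟩)
  αnb (M i) = Maybe.map embα (α ⟨ n ↑ʳ i ⟩)
  αnb (B i) = nothing
  βnb (T i) = nothing
  βnb (M i) = Maybe.map embβ (β ⟨ i ↑ˡ n ⟩)
  βnb (B i) = Maybe.map embβ (β ⟨ n ↑ʳ i ⟩)

  map-toList : ∀ {A C : Set} (f : A → C) (r : Maybe A) → List.map f (toList r) ≡ toList (Maybe.map f r)
  map-toList f nothing = refl
  map-toList f (just x) = refl

  nbrs-split : ∀ v → nbrs v ≡ toList (αnb v) ++ toList (βnb v)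
  nbrs-split (T i) = trans (map-toList embα (α ⟨ i ↑ˡ n ⟩)) (sym (++-identityʳ _))
  nbrs-split (M i) = cong₂ _++_ (map-toList embα (α ⟨ n ↑ʳ i ⟩)) (map-toList embβ (β ⟨ i ↑ˡ n ⟩))
  nbrs-split (B i) = map-toList embβ (β ⟨ n ↑ʳ i ⟩)

  Adj : V → V → Set
  Adj v w = w ∈ nbrs v

  toList-∈ : ∀ {A : Set} {x : A} {r} → x ∈ toList r → r ≡ just x
  toList-∈ {r = just y} (here refl) = refl

  ∈-toList : ∀ {A : Set} {x : A} {r} → r ≡ just x → x ∈ toList r
  ∈-toList refl = here refl

  Adj-split : ∀ {v w} → Adj v w → αnb v ≡ just w ⊎ βnb v ≡ just w
  Adj-split {v} {w} a with ++⁻ (toList (αnb v)) (subst (w ∈_) (nbrs-split v) a)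
  ... | inj₁ x = inj₁ (toList-∈ x)
  ... | inj₂ y = inj₂ (toList-∈ y)

  Adj-α : ∀ {v w} → αnb v ≡ just w → Adj v w
  Adj-α {v} e = subst (_ ∈_) (sym (nbrs-split v)) (++⁺ˡ (∈-toList e))

  Adj-β : ∀ {v w} → βnb v ≡ just w → Adj v w
  Adj-β {v} e = subst (_ ∈_) (sym (nbrs-split v)) (++⁺ʳ (toList (αnb v)) (∈-toList e))

  OddDegree : V → Bool
  OddDegree v = is-just (αnb v) xor is-just (βnb v)

  αnb-emb : ∀ k → αnb (embα k) ≡ Maybe.map embα (α ⟨ k ⟩)
  αnb-emb k with split-view {n} k
  ... | inj₁ (i , refl) rewrite embα-L i = refl
  ... | inj₂ (i , refl) rewrite embα-R i = refl

  βnb-emb : ∀ k → βnb (embβ k) ≡ Maybe.map embβ (β ⟨ k ⟩)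
  βnb-emb k with split-view {n} k
  ... | inj₁ (i , refl) rewrite embβ-L i = refl
  ... | inj₂ (i , refl) rewrite embβ-R i = refl

  αnb-dom : ∀ {v w} → αnb v ≡ just w → ∃ λ k → v ≡ embα k
  αnb-dom {T i} e = i ↑ˡ n , sym (embα-L i)
  αnb-dom {M i} e = n ↑ʳ i , sym (embα-R i)
  αnb-dom {B i} ()

  βnb-dom : ∀ {v w} → βnb v ≡ just w → ∃ λ k → v ≡ embβ k
  βnb-dom {T i} ()
  βnb-dom {M i} e = i ↑ˡ n , sym (embβ-L i)
  βnb-dom {B i} e = n ↑ʳ i , sym (embβ-R i)

  embα-inj : ∀ {k k'} → embα k ≡ embα k' → k ≡ k'
  embα-inj {k} {k'} e with split-view {n} k | split-view {n} k'
  ... | inj₁ (i , refl) | inj₁ (j , refl) rewrite embα-L i | embα-L j with e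
  ...   | refl = refl
  embα-inj e | inj₁ (i , refl) | inj₂ (j , refl) rewrite embα-L i | embα-R j with e
  ...   | ()
  embα-inj e | inj₂ (i , refl) | inj₁ (j , refl) rewrite embα-R i | embα-L j with e
  ...   | ()
  embα-inj e | inj₂ (i , refl) | inj₂ (j , refl) rewrite embα-R i | embα-R j with e
  ...   | refl = refl

  embβ-inj : ∀ {k k'} → embβ k ≡ embβ k' → k ≡ k'
  embβ-inj {k} {k'} e with split-view {n} k | split-view {n} k'
  ... | inj₁ (i , refl) | inj₁ (j , refl) rewrite embβ-L i | embβ-L j with e
  ...   | refl = refl
  embβ-inj e | inj₁ (i , refl) | inj₂ (j , refl) rewrite embβ-L i | embβ-R j with e
  ...   | ()
  embβ-inj e | inj₂ (i , refl) | inj₁ (j , refl) rewrite embβ-R i | embβ-L j with e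
  ...   | ()
  embβ-inj e | inj₂ (i , refl) | inj₂ (j , refl) rewrite embβ-R i | embβ-R j with e
  ...   | refl = refl

  module Symmetric (mα : IsMotzkin α) (mβ : IsMotzkin β) where

    αnb-sym : ∀ {v w} → αnb v ≡ just w → αnb w ≡ just v
    αnb-sym {v} e with αnb-dom {v} e
    ... | (k , refl) with map-just {f = embα} (trans (sym (αnb-emb k)) e)
    ...   | (k' , ek , refl) rewrite αnb-emb k' | IsMotzkin.symmetric mα k k' ek = refl

    αnb-irr : ∀ {v} → αnb v ≢ just v
    αnb-irr {v} e with αnb-dom {v} e
    ... | (k , refl) with map-just {f = embα} (trans (sym (αnb-emb k)) e)
    ...   | (k' , ek , ee) = IsMotzkin.irrefl mα k (subst (λ z → α ⟨ k ⟩ ≡ just z) (embα-inj ee) ek)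

    βnb-sym : ∀ {v w} → βnb v ≡ just w → βnb w ≡ just v
    βnb-sym {v} e with βnb-dom {v} e
    ... | (k , refl) with map-just {f = embβ} (trans (sym (βnb-emb k)) e)
    ...   | (k' , ek , refl) rewrite βnb-emb k' | IsMotzkin.symmetric mβ k k' ek = refl

    βnb-irr : ∀ {v} → βnb v ≢ just v
    βnb-irr {v} e with βnb-dom {v} e
    ... | (k , refl) with map-just {f = embβ} (trans (sym (βnb-emb k)) e)
    ...   | (k' , ek , ee) = IsMotzkin.irrefl mβ k (subst (λ z → β ⟨ k ⟩ ≡ just z) (embβ-inj ee) ek)

    Adj-sym : ∀ {v w} → Adj v w → Adj w v
    Adj-sym {v} {w} a with Adj-split {v} {w} a
    ... | inj₁ e = Adj-α {w} {v} (αnb-sym {v} {w} e)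
    ... | inj₂ e = Adj-β {w} {v} (βnb-sym {v} {w} e)

module Pigeonhole where

  remove : ℕ → List ℕ → List ℕ
  remove a [] = []
  remove a (x ∷ xs) with x ≟ a
  ... | yes _ = remove a xs
  ... | no _ = x ∷ remove a xs

  remove-absent : ∀ a xs → All (a ≢_) xs → remove a xs ≡ xs
  remove-absent a [] _ = refl
  remove-absent a (x ∷ xs) (h ∷ hs) with x ≟ a
  ... | yes e = ⊥-elim (h (sym e))
  ... | no _ = cong (x ∷_) (remove-absent a xs hs)

  remove-length : ∀ a xs → Unique xs → length xs ≤ suc (length (remove a xs))
  remove-length a [] _ = z≤n
  remove-length a (x ∷ xs) (h ∷ u) with x ≟ a
  ... | yes refl rewrite remove-absent x xs h = ≤-refl
  ... | no _ = s≤s (remove-length a xs u)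

  remove-All : ∀ {P : ℕ → Set} a xs → All P xs → All P (remove a xs)
  remove-All a [] _ = []
  remove-All a (x ∷ xs) (p ∷ ps) with x ≟ a
  ... | yes _ = remove-All a xs ps
  ... | no _ = p ∷ remove-All a xs ps

  remove-unique : ∀ a xs → Unique xs → Unique (remove a xs)
  remove-unique a [] _ = []
  remove-unique a (x ∷ xs) (h ∷ u) with x ≟ a
  ... | yes _ = remove-unique a xs u
  ... | no _ = remove-All a xs h ∷ remove-unique a xs u

  remove-bound : ∀ m xs → All (_< suc m) xs → All (_< m) (remove m xs)
  remove-bound m [] _ = []
  remove-bound m (x ∷ xs) (p ∷ ps) with x ≟ m
  ... | yes _ = remove-bound m xs ps
  ... | no x≢m = ≤∧≢⇒< (≤-pred p) x≢m ∷ remove-bound m xs ps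

  unique-length : ∀ m xs → Unique xs → All (_< m) xs → length xs ≤ m
  unique-length zero [] _ _ = z≤n
  unique-length zero (x ∷ xs) _ (() ∷ _)
  unique-length (suc m) xs u a =
    ≤-trans (remove-length m xs u)
            (s≤s (unique-length m (remove m xs) (remove-unique m xs u) (remove-bound m xs a)))

-- Labels are components.  comp = 3n rounds of min-propagation of idx: equal
-- labels mean connected vertices (each label is the idx of a reachable
-- vertex), and adjacent vertices get equal labels (any vertex is reached by
-- a simple path, of length < 3n).

module Components {n : ℕ} (α β : Table n) (mα : IsMotzkin α) (mβ : IsMotzkin β) where
  open Product α β
  open ProductGraph α β
  open Symmetric mα mβ

  N3 : ℕ
  N3 = n + n + n

  ≢-beyond : ∀ {a b : ℕ} c → a < c → a ≢ c + b
  ≢-beyond {a} {b} c a<c e = <-irrefl refl (≤-<-trans (subst (c ≤_) (sym e) (m≤m+n c b)) a<c)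

  idx-inj : ∀ {v w : V} → idx v ≡ idx w → v ≡ w
  idx-inj {T i} {T j} e = cong T (toℕ-injective e)
  idx-inj {T i} {M j} e = ⊥-elim (≢-beyond (n + n) (≤-trans (toℕ<n i) (m≤m+n n n)) e)
  idx-inj {T i} {B j} e = ⊥-elim (≢-beyond n (toℕ<n i) e)
  idx-inj {M i} {T j} e = ⊥-elim (≢-beyond (n + n) (≤-trans (toℕ<n j) (m≤m+n n n)) (sym e))
  idx-inj {M i} {M j} e = cong M (toℕ-injective (+-cancelˡ-≡ (n + n) _ _ e))
  idx-inj {M i} {B j} e = ⊥-elim (≢-beyond (n + n) (+-monoʳ-< n (toℕ<n j)) (sym e))
  idx-inj {B i} {T j} e = ⊥-elim (≢-beyond n (toℕ<n j) (sym e))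
  idx-inj {B i} {M j} e = ⊥-elim (≢-beyond (n + n) (+-monoʳ-< n (toℕ<n i)) e)
  idx-inj {B i} {B j} e = cong B (toℕ-injective (+-cancelˡ-≡ n _ _ e))

  idx-bound : ∀ v → idx v < N3
  idx-bound (T i) = ≤-trans (toℕ<n i) (≤-trans (m≤m+n n n) (m≤m+n (n + n) n))
  idx-bound (M i) = +-monoʳ-< (n + n) (toℕ<n i)
  idx-bound (B i) = ≤-trans (+-monoʳ-< n (toℕ<n i)) (m≤m+n (n + n) n)

  data Walk : V → V → ℕ → Set where
    [] : ∀ {v} → Walk v v 0
    _∷_ : ∀ {v x w k} → Adj v x → Walk x w k → Walk v w (suc k)

  Reach : V → V → Set
  Reach v w = ∃ λ k → Walk v w k

  _++W_ : ∀ {u v w j k} → Walk u v j → Walk v w k → Walk u w (j + k)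
  [] ++W q = q
  (a ∷ p) ++W q = a ∷ (p ++W q)

  reverse : ∀ {v w k} → Walk v w k → Reach w v
  reverse [] = 0 , []
  reverse {v} (_∷_ {x = x} a p) with reverse p
  ... | (j , q) = j + 1 , (q ++W (Adj-sym {v} {x} a ∷ []))

  step-chooses : ∀ (L : V → ℕ) z xs →
    foldr (λ w r → L w ⊓ r) z xs ≡ z ⊎ ∃ λ w → w ∈ xs × foldr (λ w r → L w ⊓ r) z xs ≡ L w
  step-chooses L z [] = inj₁ refl
  step-chooses L z (x ∷ xs) with ⊓-sel (L x) (foldr (λ w r → L w ⊓ r) z xs)
  ... | inj₁ e = inj₂ (x , here refl , e)
  ... | inj₂ e with step-chooses L z xs
  ...   | inj₁ e' = inj₁ (trans e e')
  ...   | inj₂ (w , w∈ , e') = inj₂ (w , there w∈ , trans e e')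

  iter-sound : ∀ k v → ∃ λ w → Reach v w × iter k idx v ≡ idx w
  iter-sound zero v = v , (0 , []) , refl
  iter-sound (suc k) v with step-chooses (iter k idx) (iter k idx v) (nbrs v)
  ... | inj₁ e with iter-sound k v
  ...   | (w , r , e') = w , r , trans e e'
  iter-sound (suc k) v | inj₂ (x , x∈ , e) with iter-sound k x
  ...   | (w , (j , p) , e') = w , (suc j , (x∈ ∷ p)) , trans e e'

  comp-sound : ∀ {u v} → comp u ≡ comp v → Reach u v
  comp-sound {u} {v} e with iter-sound N3 u | iter-sound N3 v
  ... | (w , (j , p) , e1) | (w' , (k , q) , e2) with idx-inj {w} {w'} (trans (sym e1) (trans e e2))
  ...   | refl with reverse q
  ...     | (k' , q') = j + k' , (p ++W q')

  first-step : ∀ {v w k} → Walk v w k → v ≢ w → ∃ λ x → Adj v x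
  first-step [] ne = ⊥-elim (ne refl)
  first-step (a ∷ p) ne = _ , a

  step-≤-self : ∀ (L : V → ℕ) z xs → foldr (λ w r → L w ⊓ r) z xs ≤ z
  step-≤-self L z [] = ≤-refl
  step-≤-self L z (x ∷ xs) = ≤-trans (m⊓n≤n (L x) _) (step-≤-self L z xs)

  step-≤-nbr : ∀ (L : V → ℕ) z xs {x} → x ∈ xs → foldr (λ w r → L w ⊓ r) z xs ≤ L x
  step-≤-nbr L z (y ∷ xs) (here refl) = m⊓n≤m (L y) _
  step-≤-nbr L z (y ∷ xs) (there x∈) = ≤-trans (m⊓n≤n (L y) _) (step-≤-nbr L z xs x∈)

  iter-antitone : ∀ j d v → iter (d + j) idx v ≤ iter j idx v
  iter-antitone j zero v = ≤-refl
  iter-antitone j (suc d) v =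
    ≤-trans (step-≤-self (iter (d + j) idx) (iter (d + j) idx v) (nbrs v)) (iter-antitone j d v)

  iter-walk : ∀ {v w j} → Walk v w j → iter j idx v ≤ idx w
  iter-walk [] = ≤-refl
  iter-walk {v} {w} {suc j} (_∷_ {x = x} a p) =
    ≤-trans (step-≤-nbr (iter j idx) (iter j idx v) (nbrs v) a) (iter-walk p)

  data Path : V → V → List V → Set where
    [] : ∀ {v} → Path v v []
    _∷_ : ∀ {v x w xs} → Adj v x → Path x w xs → Path v w (x ∷ xs)

  path-walk : ∀ {v w xs} → Path v w xs → Walk v w (length xs)
  path-walk [] = []
  path-walk (a ∷ p) = a ∷ path-walk p

  drop-until : ∀ {x w xs v} → Path x w xs → Unique (x ∷ xs) → v ∈ (x ∷ xs) →
               ∃ λ ys → Path v w ys × Unique (v ∷ ys)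
  drop-until p u (here refl) = _ , p , u
  drop-until (a ∷ p) (h ∷ u) (there v∈) = drop-until p u v∈

  _∈?_ : (v : V) (xs : List V) → Dec (v ∈ xs)
  v ∈? [] = no (λ ())
  v ∈? (x ∷ xs) with v ≟V x
  ... | yes e = yes (here e)
  ... | no ne with v ∈? xs
  ...   | yes r = yes (there r)
  ...   | no nr = no (λ { (here e) → ne e ; (there r) → nr r })

  ∉⇒All≢ : ∀ {v : V} (xs : List V) → ¬ (v ∈ xs) → All (v ≢_) xs
  ∉⇒All≢ [] _ = []
  ∉⇒All≢ (x ∷ xs) h = (λ e → h (here e)) ∷ ∉⇒All≢ xs (λ r → h (there r))

  simple-path : ∀ {v w k} → Walk v w k → ∃ λ xs → Path v w xs × Unique (v ∷ xs)
  simple-path [] = [] , [] , ([] ∷ [])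
  simple-path {v} (_∷_ {x = x} a p) with simple-path p
  ... | (xs , q , u) with v ∈? (x ∷ xs)
  ...   | yes v∈ = drop-until q u v∈
  ...   | no v∉ = x ∷ xs , (a ∷ q) , (∉⇒All≢ (x ∷ xs) v∉ ∷ u)

  all-idx-bound : ∀ (xs : List V) → All (_< N3) (List.map idx xs)
  all-idx-bound [] = []
  all-idx-bound (x ∷ xs) = idx-bound x ∷ all-idx-bound xs

  path-length : ∀ {v w xs} → Path v w xs → Unique (v ∷ xs) → length xs < N3
  path-length {v} {w} {xs} p u = subst (_≤ N3) (length-map idx (v ∷ xs))
    (Pigeonhole.unique-length N3 (List.map idx (v ∷ xs))
      (Unique.map⁺ (λ {x} {y} → idx-inj {x} {y}) u) (all-idx-bound (v ∷ xs)))

  comp-≤ : ∀ {v w} → Reach v w → comp v ≤ idx w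
  comp-≤ {v} {w} (k , p) with simple-path p
  ... | (xs , q , u) = ≤-trans
    (subst (λ z → iter z idx v ≤ iter (length xs) idx v) (m∸n+n≡m (<⇒≤ (path-length q u)))
           (iter-antitone (length xs) (N3 ∸ length xs) v))
    (iter-walk (path-walk q))

  comp-adj : ∀ {u v} → Adj u v → comp u ≡ comp v
  comp-adj {u} {v} a with iter-sound N3 u | iter-sound N3 v
  ... | (w , (j , p) , e1) | (w' , (k , q) , e2) =
    ≤-antisym (≤-trans (comp-≤ {u} {w'} (suc k , (a ∷ q))) (≤-reflexive (sym e2)))
              (≤-trans (comp-≤ {v} {w} (suc j , (Adj-sym {u} {v} a ∷ p))) (≤-reflexive (sym e1)))

-- A component of the product graph contains at most two vertices of degree
-- ≤ 1.  Each vertex has at most two neighbours, one through α and one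
-- through β, so a non-backtracking walk from a vertex of degree ≤ 1 is
-- determined by its length; two such walks reaching other vertices of
-- degree ≤ 1 must therefore end at the same vertex.

module ComponentEnds {n : ℕ} (α β : Table n) (mα : IsMotzkin α) (mβ : IsMotzkin β) where
  open Product α β using (comp)
  open ProductGraph α β
  open Symmetric mα mβ
  open Components α β mα mβ

  Lone : V → Set
  Lone v = ∀ x y → Adj v x → Adj v y → x ≡ y

  other-nbr : ∀ v p x y → Adj v p → Adj v x → Adj v y → p ≢ x → p ≢ y → x ≡ y
  other-nbr v p x y ap ax ay p≢x p≢y with Adj-split {v} ap | Adj-split {v} ax | Adj-split {v} ay
  ... | inj₁ e1 | inj₁ e2 | _ = ⊥-elim (p≢x (just-injective (trans (sym e1) e2)))
  ... | inj₂ e1 | inj₂ e2 | _ = ⊥-elim (p≢x (just-injective (trans (sym e1) e2)))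
  ... | inj₁ e1 | _ | inj₁ e3 = ⊥-elim (p≢y (just-injective (trans (sym e1) e3)))
  ... | inj₂ e1 | _ | inj₂ e3 = ⊥-elim (p≢y (just-injective (trans (sym e1) e3)))
  ... | inj₁ e1 | inj₂ e2 | inj₂ e3 = just-injective (trans (sym e2) e3)
  ... | inj₂ e1 | inj₁ e2 | inj₁ e3 = just-injective (trans (sym e2) e3)

  lone-without-α : ∀ v → αnb v ≡ nothing → Lone v
  lone-without-α v e x y ax ay with Adj-split {v} ax | Adj-split {v} ay
  ... | inj₁ e1 | _ with trans (sym e) e1
  ...   | ()
  lone-without-α v e x y ax ay | _ | inj₁ e2 with trans (sym e) e2
  ...   | ()
  lone-without-α v e x y ax ay | inj₂ e1 | inj₂ e2 = just-injective (trans (sym e1) e2)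

  lone-without-β : ∀ v → βnb v ≡ nothing → Lone v
  lone-without-β v e x y ax ay with Adj-split {v} ax | Adj-split {v} ay
  ... | inj₂ e1 | _ with trans (sym e) e1
  ...   | ()
  lone-without-β v e x y ax ay | _ | inj₂ e2 with trans (sym e) e2
  ...   | ()
  lone-without-β v e x y ax ay | inj₁ e1 | inj₁ e2 = just-injective (trans (sym e1) e2)

  -- non-backtracking walks; the index is the previous vertex, if any
  data NBWalk : Maybe V → V → V → Set where
    stop : ∀ {pr v} → NBWalk pr v v
    go : ∀ {pr v x w} → Adj v x → pr ≢ just x → NBWalk (just v) x w → NBWalk pr v w

  forget-prev : ∀ {pr v w} → NBWalk pr v w → NBWalk nothing v w
  forget-prev stop = stop
  forget-prev (go a _ r) = go a (λ ()) r

  cons : ∀ {u x w} → Adj u x → NBWalk nothing x w → NBWalk nothing u w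
  cons a stop = go a (λ ()) stop
  cons {u} a (go {x = y} b _ r) with y ≟V u
  ... | yes refl = forget-prev r
  ... | no y≢u = go a (λ ()) (go b (λ e → y≢u (sym (just-injective e))) r)

  non-backtracking : ∀ {v w k} → Walk v w k → NBWalk nothing v w
  non-backtracking [] = stop
  non-backtracking (a ∷ p) = cons a (non-backtracking p)

  module FromLone (u₀ : V) (lone₀ : Lone u₀) where
    Inv : Maybe V → V → Set
    Inv pr v = (pr ≡ nothing × v ≡ u₀) ⊎ (∃ λ p → pr ≡ just p × Adj v p)

    Continues : V → Set
    Continues w = ∃ λ pr → Inv pr w × ∃ λ x → Adj w x × pr ≢ just x

    deterministic : ∀ {pr v w z} → Inv pr v → NBWalk pr v w → NBWalk pr v z →
                    (w ≡ z) ⊎ Continues w ⊎ Continues z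
    deterministic i stop stop = inj₁ refl
    deterministic {pr} i stop (go a ne r) = inj₂ (inj₁ (pr , i , _ , a , ne))
    deterministic {pr} i (go a ne r) stop = inj₂ (inj₂ (pr , i , _ , a , ne))
    deterministic {pr} {v} i (go {x = x1} a1 ne1 r1) (go {x = x2} a2 ne2 r2) with same-step i
      where
      same-step : Inv pr v → x1 ≡ x2
      same-step (inj₁ (refl , refl)) = lone₀ x1 x2 a1 a2
      same-step (inj₂ (p , refl , ap)) =
        other-nbr v p x1 x2 ap a1 a2 (λ e → ne1 (cong just e)) (λ e → ne2 (cong just e))
    ... | refl = deterministic (inj₂ (v , refl , Adj-sym {v} {x1} a1)) r1 r2

  no-three-lone : ∀ u w z → Lone u → Lone w → Lone z → u ≢ w → u ≢ z → w ≢ z →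
                  Reach u w → Reach u z → ⊥
  no-three-lone u w z lu lw lz uw uz wz (_ , p) (_ , q)
    with FromLone.deterministic u lu (inj₁ (refl , refl)) (non-backtracking p) (non-backtracking q)
  ... | inj₁ e = wz e
  ... | inj₂ (inj₁ (pr , inj₁ (_ , e) , _)) = uw (sym e)
  ... | inj₂ (inj₁ (pr , inj₂ (p' , refl , ap) , x , ax , ne)) = ne (cong just (lw p' x ap ax))
  ... | inj₂ (inj₂ (pr , inj₁ (_ , e) , _)) = uz (sym e)
  ... | inj₂ (inj₂ (pr , inj₂ (p' , refl , ap) , x , ax , ne)) = ne (cong just (lz p' x ap ax))

  no-three-lone-labels : ∀ u w z → Lone u → Lone w → Lone z → u ≢ w → u ≢ z → w ≢ z →
                         comp u ≡ comp w → comp u ≡ comp z → ⊥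
  no-three-lone-labels u w z lu lw lz uw uz wz e1 e2 =
    no-three-lone u w z lu lw lz uw uz wz (comp-sound {u} {w} e1) (comp-sound {u} {z} e2)

module FirstMatch {A : Set} {P : Pred A 0ℓ} (P? : Decidable P) where

  first-sound : ∀ xs {v} → head (filter P? xs) ≡ just v → v ∈ xs × P v
  first-sound [] ()
  first-sound (x ∷ xs) e with P? x
  ... | yes px with e
  ...   | refl = here refl , px
  first-sound (x ∷ xs) e | no _ with first-sound xs e
  ...   | (r , pv) = there r , pv

  first-exists : ∀ xs {v} → v ∈ xs → P v → ∃ λ w → head (filter P? xs) ≡ just w
  first-exists (x ∷ xs) r pv with P? x
  ... | yes _ = x , refl
  first-exists (x ∷ xs) (here refl) pv | no npx = ⊥-elim (npx pv)
  first-exists (x ∷ xs) (there r) pv | no _ = first-exists xs r pv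

  first-unique : ∀ xs {v} → v ∈ xs → P v → (∀ w → w ∈ xs → P w → w ≡ v) →
                 head (filter P? xs) ≡ just v
  first-unique (x ∷ xs) r pv u with P? x
  ... | yes px = cong just (u x (here refl) px)
  first-unique (x ∷ xs) (here refl) pv u | no npx = ⊥-elim (npx pv)
  first-unique (x ∷ xs) (there r) pv u | no _ = first-unique xs r pv (λ w r' pw → u w (there r') pw)

-- αβ is an involutive partial matching: the partner of an outer vertex is
-- the other outer vertex with the same label, which is unique because outer
-- vertices have degree ≤ 1.

module ProductMatching {n : ℕ} (α β : Table n) (mα : IsMotzkin α) (mβ : IsMotzkin β) where
  open Product α β
  open ProductGraph α β
  open Components α β mα mβ
  open ComponentEnds α β mα mβ

  outer-view : ∀ k → (∃ λ i → k ≡ i ↑ˡ n × outer k ≡ T i)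
                   ⊎ (∃ λ i → k ≡ n ↑ʳ i × outer k ≡ B i)
  outer-view k with split-view {n} k
  ... | inj₁ (i , refl) rewrite splitAt-↑ˡ n i n = inj₁ (i , refl , refl)
  ... | inj₂ (i , refl) rewrite splitAt-↑ʳ n n i = inj₂ (i , refl , refl)

  outer-inj : ∀ {k k'} → outer k ≡ outer k' → k ≡ k'
  outer-inj {k} {k'} e with outer-view k | outer-view k'
  ... | inj₁ (i , refl , e1) | inj₁ (j , refl , e2) with trans (sym e1) (trans e e2)
  ...   | refl = refl
  outer-inj e | inj₁ (i , refl , e1) | inj₂ (j , refl , e2) with trans (sym e1) (trans e e2)
  ...   | ()
  outer-inj e | inj₂ (i , refl , e1) | inj₁ (j , refl , e2) with trans (sym e1) (trans e e2)
  ...   | ()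
  outer-inj e | inj₂ (i , refl , e1) | inj₂ (j , refl , e2) with trans (sym e1) (trans e e2)
  ...   | refl = refl

  lone-T : ∀ i → Lone (T i)
  lone-T i x y ax ay with Adj-split {T i} ax | Adj-split {T i} ay
  ... | inj₁ e1 | inj₁ e2 = just-injective (trans (sym e1) e2)
  ... | inj₂ () | _
  ... | _ | inj₂ ()

  lone-B : ∀ i → Lone (B i)
  lone-B i x y ax ay with Adj-split {B i} ax | Adj-split {B i} ay
  ... | inj₂ e1 | inj₂ e2 = just-injective (trans (sym e1) e2)
  ... | inj₁ () | _
  ... | _ | inj₁ ()

  lone-outer : ∀ k → Lone (outer k)
  lone-outer k with outer-view k
  ... | inj₁ (i , _ , e) rewrite e = lone-T i
  ... | inj₂ (i , _ , e) rewrite e = lone-B i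

  data IsOuter : V → Set where
    isT : ∀ i → IsOuter (T i)
    isB : ∀ i → IsOuter (B i)

  outer-is : ∀ k → IsOuter (outer k)
  outer-is k with outer-view k
  ... | inj₁ (i , _ , e) rewrite e = isT i
  ... | inj₂ (i , _ , e) rewrite e = isB i

  posV : V → ℕ
  posV (T i) = toℕ i
  posV (M i) = 0
  posV (B i) = n + rev i

  pos-outer : ∀ k → pos n k ≡ posV (outer k)
  pos-outer k with outer-view k
  ... | inj₁ (i , refl , e) rewrite e | splitAt-↑ˡ n i n = refl
  ... | inj₂ (i , refl , e) rewrite e | splitAt-↑ʳ n n i = refl

  partner? : ∀ u → Decidable (λ v → ¬ (v ≡ u) × (comp (outer v) ≡ comp (outer u)))
  partner? u v = ¬? (v ≟F u) ×-dec (comp (outer v) ℕ.≟ comp (outer u))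

  prod-lookup : ∀ u → prod ⟨ u ⟩ ≡ head (filter (partner? u) (allFin (n + n)))
  prod-lookup u = lookup∘tabulate (λ u → head (filter (partner? u) (allFin (n + n)))) u

  prod-sound : ∀ {u v} → prod ⟨ u ⟩ ≡ just v → v ≢ u × comp (outer v) ≡ comp (outer u)
  prod-sound {u} e =
    proj₂ (FirstMatch.first-sound (partner? u) (allFin (n + n)) (trans (sym (prod-lookup u)) e))

  prod-complete : ∀ u w → w ≢ u → comp (outer w) ≡ comp (outer u) → ∃ λ v → prod ⟨ u ⟩ ≡ just v
  prod-complete u w ne ec rewrite prod-lookup u =
    FirstMatch.first-exists (partner? u) (allFin (n + n)) (∈-allFin w) (ne , ec)

  prod-unique : ∀ u w → w ≢ u → comp (outer w) ≡ comp (outer u) →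
                (∀ w' → w' ≢ u → comp (outer w') ≡ comp (outer u) → w' ≡ w) → prod ⟨ u ⟩ ≡ just w
  prod-unique u w ne ec uq rewrite prod-lookup u =
    FirstMatch.first-unique (partner? u) (allFin (n + n)) (∈-allFin w) (ne , ec) (λ w' _ (a , b) → uq w' a b)

  no-three-outer : ∀ a b c → a ≢ b → a ≢ c → b ≢ c →
                   comp (outer a) ≡ comp (outer b) → comp (outer a) ≡ comp (outer c) → ⊥
  no-three-outer a b c ab ac bc e1 e2 =
    no-three-lone-labels (outer a) (outer b) (outer c) (lone-outer a) (lone-outer b) (lone-outer c)
      (λ e → ab (outer-inj e)) (λ e → ac (outer-inj e)) (λ e → bc (outer-inj e)) e1 e2

  prod-irrefl : ∀ u → prod ⟨ u ⟩ ≢ just u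
  prod-irrefl u e = proj₁ (prod-sound e) refl

  prod-symmetric : ∀ u v → prod ⟨ u ⟩ ≡ just v → prod ⟨ v ⟩ ≡ just u
  prod-symmetric u v e with prod-sound {u} {v} e
  ... | (v≢u , ec) = prod-unique v u (λ x → v≢u (sym x)) (sym ec) only-u
    where
    only-u : ∀ w → w ≢ v → comp (outer w) ≡ comp (outer v) → w ≡ u
    only-u w w≢v ec' with w ≟F u
    ... | yes e' = e'
    ... | no w≢u = ⊥-elim (no-three-outer u v w (λ x → v≢u (sym x)) (λ x → w≢u (sym x))
                                                 (λ x → w≢v (sym x))
                                           (sym ec) (trans (sym ec) (sym ec')))

-- The 3n vertices of the product graph are laid out on a line:
-- M 0 … M (n-1), then T (n-1) … T 0, then B (n-1) … B 0.  Read this way the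
-- boundary of α (rows T and M) is traversed in reverse cyclic order and that
-- of β (rows M and B) in cyclic order, so the α-arcs and the β-arcs become
-- two noncrossing partial matchings of {0,…,3n-1}.

module Positions {n : ℕ} (α β : Table n) (mα : IsMotzkin α) (mβ : IsMotzkin β) where
  open Product α β
  open ProductGraph α β
  open Symmetric mα mβ
  open Components α β mα mβ

  place : V → ℕ
  place (M i) = toℕ i
  place (T i) = n + rev i
  place (B i) = n + n + rev i

  place-bound : ∀ v → place v < N3
  place-bound (M i) = ≤-trans (toℕ<n i) (≤-trans (m≤m+n n n) (m≤m+n (n + n) n))
  place-bound (T i) = ≤-trans (+-monoʳ-< n (rev<n i)) (m≤m+n (n + n) n)
  place-bound (B i) = +-monoʳ-< (n + n) (rev<n i)

  vertexAt : ℕ → Maybe V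
  vertexAt p with p <? n
  ... | yes h = just (M (fromℕ< h))
  ... | no _ with p ∸ n <? n
  ...   | yes h = just (T (opposite (fromℕ< h)))
  ...   | no _ with p ∸ n ∸ n <? n
  ...     | yes h = just (B (opposite (fromℕ< h)))
  ...     | no _ = nothing

  place-vertexAt : ∀ p {v} → vertexAt p ≡ just v → place v ≡ p
  place-vertexAt p e with p <? n
  ... | yes h with e
  ...   | refl = toℕ-fromℕ< h
  place-vertexAt p e | no h1 with p ∸ n <? n
  ... | yes h with e
  ...   | refl rewrite opposite-involutive (fromℕ< h) | toℕ-fromℕ< h = m+[n∸m]≡n (≮⇒≥ h1)
  place-vertexAt p e | no h1 | no h2 with p ∸ n ∸ n <? n
  ... | yes h with e
  ...   | refl rewrite opposite-involutive (fromℕ< h) | toℕ-fromℕ< h | +-assoc n n (p ∸ n ∸ n)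
         | m+[n∸m]≡n (≮⇒≥ h2) = m+[n∸m]≡n (≮⇒≥ h1)
  place-vertexAt p () | no h1 | no h2 | no h3

  vertexAt-some : ∀ p → p < N3 → ∃ λ v → vertexAt p ≡ just v
  vertexAt-some p p< with p <? n
  ... | yes h = _ , refl
  ... | no h1 with p ∸ n <? n
  ...   | yes h = _ , refl
  ...   | no h2 with p ∸ n ∸ n <? n
  ...     | yes h = _ , refl
  ...     | no h3 = ⊥-elim (h3 (+-cancelˡ-< (n + n) _ _ (subst (_< n + n + n) (sym eq) p<)))
    where
    eq : n + n + (p ∸ n ∸ n) ≡ p
    eq = trans (+-assoc n n _) (trans (cong (_+_ n) (m+[n∸m]≡n (≮⇒≥ h2))) (m+[n∸m]≡n (≮⇒≥ h1)))

  place-inj : ∀ {v w} → place v ≡ place w → v ≡ w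
  place-inj {M i} {M j} e = cong M (toℕ-injective e)
  place-inj {M i} {T j} e = ⊥-elim (≢-beyond n (toℕ<n i) e)
  place-inj {M i} {B j} e = ⊥-elim (≢-beyond n (toℕ<n i) (trans e (+-assoc n n _)))
  place-inj {T i} {M j} e = ⊥-elim (≢-beyond n (toℕ<n j) (sym e))
  place-inj {T i} {T j} e = cong T (rev-inj (+-cancelˡ-≡ n _ _ e))
  place-inj {T i} {B j} e = ⊥-elim (≢-beyond n (rev<n i) (+-cancelˡ-≡ n _ _ (trans e (+-assoc n n _))))
  place-inj {B i} {M j} e = ⊥-elim (≢-beyond n (toℕ<n j) (trans (sym e) (+-assoc n n _)))
  place-inj {B i} {T j} e = ⊥-elim (≢-beyond n (rev<n j) (+-cancelˡ-≡ n _ _ (trans (sym e) (+-assoc n n _))))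
  place-inj {B i} {B j} e = cong B (rev-inj (+-cancelˡ-≡ (n + n) _ _ e))

  vertexAt-place : ∀ v → vertexAt (place v) ≡ just v
  vertexAt-place v with vertexAt-some (place v) (place-bound v)
  ... | (w , e) = trans e (cong just (place-inj {w} {v} (place-vertexAt (place v) e)))

  vertexAt-none : ∀ p → vertexAt p ≡ nothing → ∀ v → place v ≢ p
  vertexAt-none p e v refl with trans (sym (vertexAt-place v)) e
  ... | ()

  αpos : ℕ → Maybe ℕ
  αpos p = vertexAt p Maybe.>>= λ v → Maybe.map place (αnb v)

  βpos : ℕ → Maybe ℕ
  βpos p = vertexAt p Maybe.>>= λ v → Maybe.map place (βnb v)

  αpos-place : ∀ v → αpos (place v) ≡ Maybe.map place (αnb v)
  αpos-place v rewrite vertexAt-place v = refl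

  βpos-place : ∀ v → βpos (place v) ≡ Maybe.map place (βnb v)
  βpos-place v rewrite vertexAt-place v = refl

  partner-inv : ∀ (f : V → Maybe V) p q → (vertexAt p Maybe.>>= λ v → Maybe.map place (f v)) ≡ just q →
          ∃₂ λ v w → place v ≡ p × place w ≡ q × f v ≡ just w
  partner-inv f p q e with vertexAt p in ev
  ... | just v with f v in ef
  ...   | just w with e
  ...     | refl = v , w , place-vertexAt p ev , refl , ef

  αpos-inv : ∀ p q → αpos p ≡ just q → ∃₂ λ v w → place v ≡ p × place w ≡ q × αnb v ≡ just w
  αpos-inv = partner-inv αnb
  βpos-inv : ∀ p q → βpos p ≡ just q → ∃₂ λ v w → place v ≡ p × place w ≡ q × βnb v ≡ just w
  βpos-inv = partner-inv βnb

  αpos-sym : ∀ p q → αpos p ≡ just q → αpos q ≡ just p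
  αpos-sym p q e with αpos-inv p q e
  ... | (v , w , refl , refl , e') rewrite αpos-place w | αnb-sym {v} {w} e' = refl

  βpos-sym : ∀ p q → βpos p ≡ just q → βpos q ≡ just p
  βpos-sym p q e with βpos-inv p q e
  ... | (v , w , refl , refl , e') rewrite βpos-place w | βnb-sym {v} {w} e' = refl

  αpos-irrefl : ∀ p → αpos p ≢ just p
  αpos-irrefl p e with αpos-inv p p e
  ... | (v , w , e1 , e2 , e') rewrite place-inj {v} {w} (trans e1 (sym e2)) = αnb-irr {w} e'

  βpos-irrefl : ∀ p → βpos p ≢ just p
  βpos-irrefl p e with βpos-inv p p e
  ... | (v , w , e1 , e2 , e') rewrite place-inj {v} {w} (trans e1 (sym e2)) = βnb-irr {w} e'

  αpos-bound : ∀ p q → αpos p ≡ just q → q < N3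
  αpos-bound p q e with αpos-inv p q e
  ... | (v , w , _ , refl , _) = place-bound w

  βpos-bound : ∀ p q → βpos p ≡ just q → q < N3
  βpos-bound p q e with βpos-inv p q e
  ... | (v , w , _ , refl , _) = place-bound w

  place-αarc : ∀ {v w} → αnb v ≡ just w → place v < n + n
  place-αarc {T i} e = +-monoʳ-< n (rev<n i)
  place-αarc {M i} e = ≤-trans (toℕ<n i) (m≤m+n n n)
  place-αarc {B i} ()

  αpos-below-2n : ∀ p q → αpos p ≡ just q → q < n + n
  αpos-below-2n p q e with αpos-inv p q e
  ... | (v , w , _ , refl , e') = place-αarc {w} (αnb-sym {v} {w} e')

  place+pos-α : ∀ k → place (embα k) + pos n k ≡ n + n ∸ 1
  place+pos-α k with split-view {n} k
  ... | inj₁ (i , refl) rewrite embα-L i | splitAt-↑ˡ n i n = goal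
    where
    goal : n + rev i + toℕ i ≡ n + n ∸ 1
    goal = sym (trans (cong (λ z → n + z ∸ 1) (sym (rev-sum i)))
                      (trans (cong (_∸ 1) (+-suc n _)) (sym (+-assoc n (rev i) (toℕ i)))))
  ... | inj₂ (i , refl) rewrite embα-R i | splitAt-↑ʳ n n i = goal
    where
    goal : toℕ i + (n + rev i) ≡ n + n ∸ 1
    goal = sym (trans (cong (λ z → n + z ∸ 1) (sym (rev-sum i)))
                (trans (cong (_∸ 1) (+-suc n _))
                  (trans (sym (+-assoc n (rev i) (toℕ i))) (+-comm (n + rev i) (toℕ i)))))

  α-reverses-pos : ∀ {k k'} → place (embα k) < place (embα k') → pos n k' < pos n k
  α-reverses-pos {k} {k'} h = sum-flip (trans (place+pos-α k) (sym (place+pos-α k'))) h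

  β-preserves-pos : ∀ {k k'} → place (embβ k) < place (embβ k') → pos n k < pos n k'
  β-preserves-pos {k} {k'} h with split-view {n} k | split-view {n} k'
  ... | inj₁ (i , refl) | inj₁ (j , refl)
    rewrite embβ-L i | embβ-L j | splitAt-↑ˡ n i n | splitAt-↑ˡ n j n = h
  ... | inj₁ (i , refl) | inj₂ (j , refl)
    rewrite embβ-L i | embβ-R j | splitAt-↑ˡ n i n | splitAt-↑ʳ n n j = ≤-trans (toℕ<n i) (m≤m+n n (rev j))
  ... | inj₂ (i , refl) | inj₁ (j , refl) rewrite embβ-R i | embβ-L j =
        ⊥-elim (<-irrefl refl (≤-<-trans (≤-trans (m≤m+n n n) (m≤m+n (n + n) (rev i))) (<-trans h (toℕ<n j))))
  ... | inj₂ (i , refl) | inj₂ (j , refl)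
    rewrite embβ-R i | embβ-R j | splitAt-↑ʳ n n i | splitAt-↑ʳ n n j = +-monoʳ-< n (+-cancelˡ-< (n + n) _ _ h)

  αpos-nc : ∀ p q r s → αpos p ≡ just q → αpos r ≡ just s → ¬ (p < r × r < q × q < s)
  αpos-nc p q r s e1 e2 (h1 , h2 , h3) with αpos-inv p q e1 | αpos-inv r s e2
  ... | (v , w , refl , refl , a1) | (x , y , refl , refl , a2) with αnb-dom {v} a1 | αnb-dom {x} a2
  ... | (kv , refl) | (kx , refl)
    with map-just {f = embα} (trans (sym (αnb-emb kv)) a1) | map-just {f = embα} (trans (sym (αnb-emb kx)) a2)
  ... | (kw , ew , refl) | (ky , ey , refl) =
        IsMotzkin.planar mα ky kx kw kv (IsMotzkin.symmetric mα kx ky ey) (IsMotzkin.symmetric mα kv kw ew)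
          (α-reverses-pos {kw} {ky} h3 , α-reverses-pos {kx} {kw} h2 , α-reverses-pos {kv} {kx} h1)

  βpos-nc : ∀ p q r s → βpos p ≡ just q → βpos r ≡ just s → ¬ (p < r × r < q × q < s)
  βpos-nc p q r s e1 e2 (h1 , h2 , h3) with βpos-inv p q e1 | βpos-inv r s e2
  ... | (v , w , refl , refl , a1) | (x , y , refl , refl , a2) with βnb-dom {v} a1 | βnb-dom {x} a2
  ... | (kv , refl) | (kx , refl)
    with map-just {f = embβ} (trans (sym (βnb-emb kv)) a1) | map-just {f = embβ} (trans (sym (βnb-emb kx)) a2)
  ... | (kw , ew , refl) | (ky , ey , refl) =
        IsMotzkin.planar mβ kv kw kx ky ew ey
          (β-preserves-pos {kv} {kx} h1 , β-preserves-pos {kx} {kw} h2 , β-preserves-pos {kw} {ky} h3)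

-- Fix a label c₀; the
-- positions of the vertices labelled c₀ form a set P closed under both
-- matchings, giving cut parities for the α-arcs and for the β-arcs of the
-- component.

module ComponentParity {n : ℕ} (α β : Table n) (mα : IsMotzkin α) (mβ : IsMotzkin β) (c₀ : ℕ) where
  open ParitySums
  open Product α β
  open ProductGraph α β
  open Symmetric mα mβ
  open Components α β mα mβ
  open Positions α β mα mβ

  inPv : V → Bool
  inPv v = eqb (comp v) c₀

  inP : ℕ → Bool
  inP p = Maybe.maybe inPv false (vertexAt p)

  inP-place : ∀ v → inP (place v) ≡ inPv v
  inP-place v rewrite vertexAt-place v = refl

  inPv-adj : ∀ {v w} → Adj v w → inPv v ≡ inPv w
  inPv-adj {v} {w} a = cong (λ z → eqb z c₀) (comp-adj {v} {w} a)

  αpos-closed : ∀ p q → αpos p ≡ just q → inP p ≡ inP q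
  αpos-closed p q e with αpos-inv p q e
  ... | (v , w , refl , refl , e') rewrite inP-place v | inP-place w = inPv-adj {v} {w} (Adj-α {v} e')

  βpos-closed : ∀ p q → βpos p ≡ just q → inP p ≡ inP q
  βpos-closed p q e with βpos-inv p q e
  ... | (v , w , refl , refl , e') rewrite inP-place v | inP-place w = inPv-adj {v} {w} (Adj-β {v} e')

  module αCuts = NoncrossingParity N3 αpos inP αpos-sym αpos-irrefl αpos-bound αpos-closed αpos-nc
  module βCuts = NoncrossingParity N3 βpos inP βpos-sym βpos-irrefl βpos-bound βpos-closed βpos-nc

  αmatched-place : ∀ v → αCuts.matched (place v) ≡ inPv v ∧ is-just (αnb v)
  αmatched-place v rewrite inP-place v | αpos-place v | is-just-map place (αnb v) = refl

  βmatched-place : ∀ v → βCuts.matched (place v) ≡ inPv v ∧ is-just (βnb v)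
  βmatched-place v rewrite inP-place v | βpos-place v | is-just-map place (βnb v) = refl

  degree-place : ∀ v → (αCuts.matched (place v) xor βCuts.matched (place v)) ≡ inPv v ∧ OddDegree v
  degree-place v rewrite αmatched-place v | βmatched-place v with inPv v
  ... | true = refl
  ... | false = refl

  handshake : parity (λ p → αCuts.matched p xor βCuts.matched p) N3 ≡ false
  handshake = begin
      parity (λ p → αCuts.matched p xor βCuts.matched p) N3
    ≡⟨ parity-xor αCuts.matched βCuts.matched N3 ⟩
      parity αCuts.matched N3 xor parity βCuts.matched N3
    ≡⟨ cong₂ _xor_ (αCuts.crossings≡matched-before N3) (βCuts.crossings≡matched-before N3) ⟨
      αCuts.crossings N3 xor βCuts.crossings N3
    ≡⟨ cong₂ _xor_ (αCuts.crossings-beyond N3 αpos-bound) (βCuts.crossings-beyond N3 βpos-bound) ⟩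
      false ∎
    where open ≡-Reasoning

  matched-nowhere : ∀ p → vertexAt p ≡ nothing → αCuts.matched p ≡ false × βCuts.matched p ≡ false
  matched-nowhere p e rewrite e = refl , refl

  T-between : ∀ p → n ≤ p → p < n + n → ∃ λ i → vertexAt p ≡ just (T i)
  T-between p h1 h2 with vertexAt-some p (≤-trans h2 (m≤m+n (n + n) n))
  ... | (M i , e) = ⊥-elim (<-irrefl refl (≤-<-trans h1 (subst (_< n) (place-vertexAt p e) (toℕ<n i))))
  ... | (T i , e) = i , e
  ... | (B i , e) =
    ⊥-elim (<-irrefl refl (<-≤-trans h2 (subst (n + n ≤_) (place-vertexAt p e) (m≤m+n (n + n) (rev i)))))

  βunmatched-T : ∀ p → n ≤ p → p < n + n → βCuts.matched p ≡ false
  βunmatched-T p h1 h2 with T-between p h1 h2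
  ... | (i , e) = trans (cong βCuts.matched (sym (place-vertexAt p e)))
                        (trans (βmatched-place (T i)) (∧-zeroʳ (inPv (T i))))

  βcrossings-flat-over-T : ∀ k → k ≤ n → βCuts.crossings (n + k) ≡ βCuts.crossings n
  βcrossings-flat-over-T k k≤n = begin
      βCuts.crossings (n + k)
    ≡⟨ βCuts.crossings≡matched-before (n + k) ⟩
      parity βCuts.matched (n + k)
    ≡⟨ parity-skip βCuts.matched n k (λ p h1 h2 → βunmatched-T p h1 (<-≤-trans h2 (+-monoʳ-≤ n k≤n))) ⟩
      parity βCuts.matched n
    ≡⟨ βCuts.crossings≡matched-before n ⟨
      βCuts.crossings n ∎
    where open ≡-Reasoning

  αcrossings-beyond-2n : ∀ t → n + n ≤ t → αCuts.crossings t ≡ false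
  αcrossings-beyond-2n t h = αCuts.crossings-beyond t (λ p q e → <-≤-trans (αpos-below-2n p q e) h)

-- Let a — b be an arc of αβ and C the component joining
-- them.  Every vertex of C except a and b has degree 2, so at each cut the
-- α- and β-arcs of C together cross it an odd number of times exactly when
-- the cut separates a from b (crossings-total).  This defines for vertices
-- outside C a side of C that is constant along arcs outside C, and on outer
-- vertices it is "between a and b on the boundary".  An arc c — d of αβ
-- with a < c < b < d would join vertices on different sides.

module Planarity {n : ℕ} (α β : Table n) (mα : IsMotzkin α) (mβ : IsMotzkin β) where
  open ParitySums
  open Product α β
  open ProductGraph α β
  open Symmetric mα mβ
  open Components α β mα mβ
  open ComponentEnds α β mα mβ
  open ProductMatching α β mα mβ
  open Positions α β mα mβ

  place-outer-≥ : ∀ {v} → IsOuter v → n ≤ place v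
  place-outer-≥ (isT i) = m≤m+n n (rev i)
  place-outer-≥ (isB i) = ≤-trans (m≤m+n n n) (m≤m+n (n + n) (rev i))

  separates-T : ∀ {v} (j : Fin n) → IsOuter v → v ≢ T j →
                (lt (place v) (n + n) xor lt (place v) (n + rev j)) ≡ lt (posV v) (toℕ j)
  separates-T j (isT i) ne rewrite lt-yes {n + rev i} {n + n} (+-monoʳ-< n (rev<n i))
    with <-cmp (toℕ i) (toℕ j)
  ... | tri< h _ _ rewrite lt-yes h
                         | lt-no {n + rev i} {n + rev j} (λ x → <-asym (rev-antitone h) (+-cancelˡ-< n _ _ x)) = refl
  ... | tri≈ _ h _ = ⊥-elim (ne (cong T (toℕ-injective h)))
  ... | tri> _ _ h rewrite lt-no (<-asym h) | lt-yes {n + rev i} {n + rev j} (+-monoʳ-< n (rev-antitone h)) = refl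
  separates-T j (isB i) ne
    rewrite lt-no {n + n + rev i} {n + n} (λ x → <-irrefl refl (<-≤-trans x (m≤m+n (n + n) (rev i))))
          | lt-no {n + n + rev i} {n + rev j}
              (λ x → <-irrefl refl (<-≤-trans x (≤-trans (+-monoʳ-≤ n (<⇒≤ (rev<n j))) (m≤m+n (n + n) (rev i)))))
          | lt-no {n + rev i} {toℕ j} (λ x → <-irrefl refl (<-≤-trans (<-trans x (toℕ<n j)) (m≤m+n n (rev i)))) = refl

  separates-B : ∀ {v} (j : Fin n) → IsOuter v → lt (place v) (n + n + rev j) ≡ lt (posV v) (n + rev j)
  separates-B j (isT i)
    rewrite lt-yes {n + rev i} {n + n + rev j} (≤-trans (+-monoʳ-< n (rev<n i)) (m≤m+n (n + n) (rev j)))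
          | lt-yes {toℕ i} {n + rev j} (≤-trans (toℕ<n i) (m≤m+n n (rev j))) = refl
  separates-B j (isB i) with rev i <? rev j
  ... | yes h rewrite lt-yes {n + n + rev i} {n + n + rev j} (+-monoʳ-< (n + n) h)
                    | lt-yes {n + rev i} {n + rev j} (+-monoʳ-< n h) = refl
  ... | no h rewrite lt-no {n + n + rev i} {n + n + rev j} (λ x → h (+-cancelˡ-< (n + n) _ _ x))
                   | lt-no {n + rev i} {n + rev j} (λ x → h (+-cancelˡ-< n _ _ x)) = refl

  xor-false : ∀ {x y} → x xor y ≡ false → x ≡ y
  xor-false {false} {false} _ = refl
  xor-false {true} {true} _ = refl

  xor-solve : ∀ {x y z} → x xor y ≡ z → x ≡ y xor z
  xor-solve {false} {false} refl = refl
  xor-solve {false} {true} refl = refl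
  xor-solve {true} {false} refl = refl
  xor-solve {true} {true} refl = refl

  module ArcComponent (a b : Fin (n + n)) (hab : prod ⟨ a ⟩ ≡ just b) where
    va vb : V
    va = outer a
    vb = outer b
    open ComponentParity α β mα mβ (comp va)

    b≢a : b ≢ a
    b≢a = proj₁ (prod-sound hab)
    cb : comp vb ≡ comp va
    cb = proj₂ (prod-sound hab)

    va≢vb : va ≢ vb
    va≢vb e = b≢a (sym (outer-inj e))

    end-odd : ∀ {v} → IsOuter v → (∃ λ x → Adj v x) → OddDegree v ≡ true
    end-odd (isT i) (x , ax) with Adj-split {T i} ax
    ... | inj₁ e rewrite e = refl
    end-odd (isB i) (x , ax) with Adj-split {B i} ax
    ... | inj₂ e rewrite e = refl

    va-odd : OddDegree va ≡ true
    va-odd = end-odd (outer-is a) (first-step (proj₂ (comp-sound {va} {vb} (sym cb))) va≢vb)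

    vb-odd : OddDegree vb ≡ true
    vb-odd = end-odd (outer-is b) (first-step (proj₂ (comp-sound {vb} {va} cb)) (λ e → va≢vb (sym e)))

    inner-even : ∀ v → comp v ≡ comp va → v ≢ va → v ≢ vb → OddDegree v ≡ false
    inner-even v ec na nb with αnb v in e1 | βnb v in e2
    ... | just _ | just _ = refl
    ... | nothing | _ = ⊥-elim (no-three-lone-labels va vb v (lone-outer a) (lone-outer b) (lone-without-α v e1)
                                  va≢vb (λ e → na (sym e)) (λ e → nb (sym e)) (sym cb) (sym ec))
    ... | just _ | nothing = ⊥-elim (no-three-lone-labels va vb v (lone-outer a) (lone-outer b) (lone-without-β v e2)
                                       va≢vb (λ e → na (sym e)) (λ e → nb (sym e)) (sym cb) (sym ec))

    eqb-place-no : ∀ {v w} → v ≢ w → eqb (place w) (place v) ≡ false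
    eqb-place-no ne = eqb-no (λ e → ne (place-inj (sym e)))

    degree-parity-at : ∀ v → (αCuts.matched (place v) xor βCuts.matched (place v))
                             ≡ (eqb (place va) (place v) xor eqb (place vb) (place v))
    degree-parity-at v rewrite αmatched-place v | βmatched-place v with comp v ≟ comp va
    ... | no ne rewrite eqb-no ne | eqb-place-no {v} {va} (λ e → ne (cong comp e))
                      | eqb-place-no {v} {vb} (λ e → ne (trans (cong comp e) cb)) = refl
    ... | yes ec rewrite eqb-yes ec with v ≟V va
    ...   | yes refl rewrite eqb-yes {place va} refl | eqb-place-no {va} {vb} va≢vb = va-odd
    ...   | no na with v ≟V vb
    ...     | yes refl rewrite eqb-yes {place vb} refl | eqb-place-no {vb} {va} (λ e → va≢vb (sym e)) = vb-odd
    ...     | no nb rewrite eqb-place-no {v} {va} na | eqb-place-no {v} {vb} nb = inner-even v ec na nb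

    degree-parity : ∀ p → (αCuts.matched p xor βCuts.matched p) ≡ (eqb (place va) p xor eqb (place vb) p)
    degree-parity p = at (vertexAt p) refl
      where
      at : ∀ r → vertexAt p ≡ r → (αCuts.matched p xor βCuts.matched p) ≡ (eqb (place va) p xor eqb (place vb) p)
      at (just v) ev = subst (λ z → (αCuts.matched z xor βCuts.matched z) ≡ (eqb (place va) z xor eqb (place vb) z))
                             (place-vertexAt p ev) (degree-parity-at v)
      at nothing ev rewrite proj₁ (matched-nowhere p ev) | proj₂ (matched-nowhere p ev)
                          | eqb-no (vertexAt-none p ev va) | eqb-no (vertexAt-none p ev vb) = refl

    separates : ℕ → Bool
    separates t = lt (place va) t xor lt (place vb) t

    crossings-total : ∀ t → αCuts.crossings t xor βCuts.crossings t ≡ separates t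
    crossings-total t rewrite αCuts.crossings≡matched-before t | βCuts.crossings≡matched-before t = begin
        parity αCuts.matched t xor parity βCuts.matched t
      ≡⟨ parity-xor αCuts.matched βCuts.matched t ⟨
        parity (λ p → αCuts.matched p xor βCuts.matched p) t
      ≡⟨ parity-cong t (λ p _ → degree-parity p) ⟩
        parity (λ p → eqb (place va) p xor eqb (place vb) p) t
      ≡⟨ parity-xor (eqb (place va)) (eqb (place vb)) t ⟩
        parity (λ p → true ∧ eqb (place va) p) t xor parity (λ p → true ∧ eqb (place vb) p) t
      ≡⟨ cong₂ _xor_ (parity-point (λ _ → true) (place va) t) (parity-point (λ _ → true) (place vb) t) ⟩
        separates t ∎
      where open ≡-Reasoning

    side : V → Bool
    side (T i) = αCuts.crossings (place (T i))
    side (M i) = αCuts.crossings (place (M i))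
    side (B i) = βCuts.crossings (place (B i))

    -- at a middle vertex both crossing counts agree, as a and b lie further right
    side-M : ∀ i → αCuts.crossings (toℕ i) ≡ βCuts.crossings (toℕ i)
    side-M i = xor-false (trans (crossings-total (toℕ i))
                                (cong₂ _xor_ (before-M (outer-is a)) (before-M (outer-is b))))
      where
      before-M : ∀ {v} → IsOuter v → lt (place v) (toℕ i) ≡ false
      before-M ov = lt-no (λ x → <-irrefl refl (≤-<-trans (place-outer-≥ ov) (<-trans x (toℕ<n i))))

    side-α : ∀ {v x} → αnb v ≡ just x → side v ≡ αCuts.crossings (place v)
    side-α {T i} e = refl
    side-α {M i} e = refl
    side-α {B i} ()

    side-β : ∀ {v x} → βnb v ≡ just x → side v ≡ βCuts.crossings (place v)
    side-β {T i} ()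
    side-β {M i} e = side-M i
    side-β {B i} e = refl

    side-step : ∀ v w → Adj v w → inPv v ≡ false → side v ≡ side w
    side-step v w ad iv with Adj-split {v} ad
    ... | inj₁ e = trans (side-α {v} e)
        (trans (αCuts.crossings-arc-outside (place v) (place w)
                  (trans (αpos-place v) (cong (Maybe.map place) e)) (trans (inP-place v) iv))
               (sym (side-α {w} (αnb-sym {v} {w} e))))
    ... | inj₂ e = trans (side-β {v} e)
        (trans (βCuts.crossings-arc-outside (place v) (place w)
                  (trans (βpos-place v) (cong (Maybe.map place) e)) (trans (inP-place v) iv))
               (sym (side-β {w} (βnb-sym {v} {w} e))))

    side-walk : ∀ {v w k} → Walk v w k → inPv v ≡ false → side v ≡ side w
    side-walk [] _ = refl
    side-walk {v} (_∷_ {x = x} ad p) iv =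
      trans (side-step v x ad iv) (side-walk p (trans (sym (inPv-adj {v} {x} ad)) iv))

    side-T : ∀ j → side (T j) ≡ separates (n + n) xor separates (n + rev j)
    side-T j = begin
        αCuts.crossings (n + rev j)
      ≡⟨ xor-solve (crossings-total (n + rev j)) ⟩
        βCuts.crossings (n + rev j) xor separates (n + rev j)
      ≡⟨ cong (_xor separates (n + rev j))
              (trans (βcrossings-flat-over-T (rev j) (<⇒≤ (rev<n j))) (sym (βcrossings-flat-over-T n ≤-refl))) ⟩
        βCuts.crossings (n + n) xor separates (n + rev j)
      ≡⟨ cong (_xor separates (n + rev j))
              (trans (sym (cong (_xor βCuts.crossings (n + n)) (αcrossings-beyond-2n (n + n) ≤-refl)))
                     (crossings-total (n + n))) ⟩
        separates (n + n) xor separates (n + rev j) ∎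
      where open ≡-Reasoning

    side-B : ∀ j → side (B j) ≡ separates (n + n + rev j)
    side-B j = trans (sym (cong (_xor βCuts.crossings (n + n + rev j))
                                (αcrossings-beyond-2n (n + n + rev j) (m≤m+n (n + n) (rev j)))))
                     (crossings-total (n + n + rev j))

    side-outer : ∀ {x} → IsOuter x → x ≢ va → x ≢ vb →
                 side x ≡ lt (posV va) (posV x) xor lt (posV vb) (posV x)
    side-outer (isT j) na nb =
      trans (side-T j)
            (trans (xor-interchange (lt (place va) (n + n)) (lt (place vb) (n + n))
                                    (lt (place va) (n + rev j)) (lt (place vb) (n + rev j)))
                   (cong₂ _xor_ (separates-T j (outer-is a) (λ e → na (sym e)))
                                (separates-T j (outer-is b) (λ e → nb (sym e)))))
    side-outer (isB j) na nb =
      trans (side-B j) (cong₂ _xor_ (separates-B j (outer-is a)) (separates-B j (outer-is b)))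

    -- c is on the inner side, d on the outer one, yet a walk outside the component joins them
    no-crossing-arc : ∀ c d → prod ⟨ c ⟩ ≡ just d →
                      pos n a < pos n c → pos n c < pos n b → pos n b < pos n d → ⊥
    no-crossing-arc c d hcd h1 h2 h3 with comp-sound {outer c} {outer d} (sym (proj₂ (prod-sound hcd)))
    ... | (_ , p) with trans (sym side-c) (trans (side-walk p c-outside) side-d)
      where
      ≢-pos : ∀ {x y} → pos n x < pos n y → outer x ≢ outer y
      ≢-pos h e = <-irrefl (cong (pos n) (outer-inj e)) h
      c-outside : inPv (outer c) ≡ false
      c-outside = eqb-no (λ ec → no-three-outer a b c (λ e → ≢-pos (<-trans h1 h2) (cong outer e))
                                  (λ e → ≢-pos h1 (cong outer e)) (λ e → ≢-pos h2 (cong outer (sym e)))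
                                  (sym cb) (sym ec))
      side-c : side (outer c) ≡ true
      side-c rewrite side-outer (outer-is c) (λ e → ≢-pos h1 (sym e)) (≢-pos h2)
                   | sym (pos-outer a) | sym (pos-outer b) | sym (pos-outer c)
                   | lt-yes h1 | lt-no (<-asym h2) = refl
      side-d : side (outer d) ≡ false
      side-d rewrite side-outer (outer-is d) (λ e → ≢-pos (<-trans (<-trans h1 h2) h3) (sym e))
                                (λ e → ≢-pos h3 (sym e))
                   | sym (pos-outer a) | sym (pos-outer b) | sym (pos-outer d)
                   | lt-yes (<-trans (<-trans h1 h2) h3) | lt-yes h3 = refl
    ...   | ()

  prod-motzkin : IsMotzkin prod
  prod-motzkin = record
    { irrefl = prod-irrefl
    ; symmetric = prod-symmetric
    ; planar = λ a b c d hab hcd (h1 , h2 , h3) → ArcComponent.no-crossing-arc a b hab c d hcd h1 h2 h3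
    }

-- Now outer vertices have degree 1 and
-- middle vertices degree 2; by the handshake lemma the component of an outer
-- vertex u contains a second vertex of odd degree, an outer vertex, which
-- is a partner of u.

module JonesTotality {n : ℕ} (α β : Table n) (jα : IsJones α) (jβ : IsJones β) where
  open ParitySums
  mα : IsMotzkin α
  mα = IsJones.motzkin jα
  mβ : IsMotzkin β
  mβ = IsJones.motzkin jβ
  open Product α β
  open ProductGraph α β
  open Components α β mα mβ
  open ProductMatching α β mα mβ
  open Positions α β mα mβ

  α-total : ∀ k → is-just (Maybe.map embα (α ⟨ k ⟩)) ≡ true
  α-total k with IsJones.total jα k
  ... | (k' , e) rewrite e = refl

  β-total : ∀ k → is-just (Maybe.map embβ (β ⟨ k ⟩)) ≡ true
  β-total k with IsJones.total jβ k
  ... | (k' , e) rewrite e = refl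

  even-M : ∀ i → OddDegree (M i) ≡ false
  even-M i rewrite α-total (n ↑ʳ i) | β-total (i ↑ˡ n) = refl

  odd-T : ∀ i → OddDegree (T i) ≡ true
  odd-T i rewrite α-total (i ↑ˡ n) = refl

  odd-B : ∀ i → OddDegree (B i) ≡ true
  odd-B i rewrite β-total (n ↑ʳ i) = refl

  outer-T : ∀ i → outer (i ↑ˡ n) ≡ T i
  outer-T i rewrite splitAt-↑ˡ n i n = refl

  outer-B : ∀ i → outer (n ↑ʳ i) ≡ B i
  outer-B i rewrite splitAt-↑ʳ n n i = refl

  module OfOuter (u : Fin (n + n)) where
    vu : V
    vu = outer u
    open ComponentParity α β mα mβ (comp vu)

    degree : ℕ → Bool
    degree p = αCuts.matched p xor βCuts.matched p

    vu-odd : degree (place vu) ≡ true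
    vu-odd rewrite degree-place vu | eqb-yes {comp vu} refl with outer-view u
    ... | inj₁ (i , _ , e) rewrite e = odd-T i
    ... | inj₂ (i , _ , e) rewrite e = odd-B i

    others : ℕ → Bool
    others p = degree p xor eqb (place vu) p

    others-odd : parity others N3 ≡ true
    others-odd = begin
        parity others N3
      ≡⟨ parity-xor degree (eqb (place vu)) N3 ⟩
        parity degree N3 xor parity (λ p → true ∧ eqb (place vu) p) N3
      ≡⟨ cong₂ _xor_ handshake (parity-point (λ _ → true) (place vu) N3) ⟩
        lt (place vu) N3
      ≡⟨ lt-yes (place-bound vu) ⟩
        true ∎
      where open ≡-Reasoning

    another-odd : ∃ λ v → v ≢ vu × inPv v ≡ true × OddDegree v ≡ true
    another-odd with parity-true others N3 others-odd
    ... | (p , p<N3 , odd-p) with vertexAt-some p p<N3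
    ...   | (v , e) with subst (λ z → others z ≡ true) (sym (place-vertexAt p e)) odd-p
    ...     | odd-v with v ≟V vu
    ...       | yes refl rewrite vu-odd | eqb-yes {place vu} refl with odd-v
    ...         | ()
    another-odd | (p , _ , _) | (v , e) | odd-v | no v≢vu
      rewrite eqb-no {place vu} {place v} (λ e → v≢vu (place-inj (sym e))) | xor-identityʳ (degree (place v))
            | degree-place v with inPv v in inC | OddDegree v in odd
    ... | true | true = v , v≢vu , inC , odd
    ... | false | _ with odd-v
    ...   | ()
    another-odd | _ | _ | odd-v | no v≢vu | true | false with odd-v
    ...   | ()

    -- being of odd degree, that vertex is outer, hence a partner of u
    has-partner : ∃ λ w → prod ⟨ u ⟩ ≡ just w
    has-partner with another-odd
    ... | (M i , _ , _ , odd) with trans (sym (even-M i)) odd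
    ...   | ()
    has-partner | (T i , v≢vu , inC , _) =
      prod-complete u (i ↑ˡ n) (λ e → v≢vu (trans (sym (outer-T i)) (cong outer e)))
                    (trans (cong comp (outer-T i)) (eqb-true inC))
    has-partner | (B i , v≢vu , inC , _) =
      prod-complete u (n ↑ʳ i) (λ e → v≢vu (trans (sym (outer-B i)) (cong outer e)))
                    (trans (cong comp (outer-B i)) (eqb-true inC))

  prod-jones : IsJones prod
  prod-jones = record { motzkin = Planarity.prod-motzkin α β mα mβ ; total = OfOuter.has-partner }

closure : ∀ k {n} {α β : Table n} → InS k α → InS k β → InS k (α · β)
closure motzkin {n} {α} {β} mα mβ = Planarity.prod-motzkin α β mα mβ
closure jones {n} {α} {β} jα jβ = JonesTotality.prod-jones α β jα jβ

module IntegerPowers {c ℓ} (K : CommutativeRing c ℓ) (ξ ξ⁻¹ : CommutativeRing.Carrier K)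
  (ξξ⁻¹≈1 : CommutativeRing._≈_ K (CommutativeRing._*_ K ξ ξ⁻¹) (CommutativeRing.1# K)) where
  open CommutativeRing K
    using (Carrier; _≈_; _*_; 1#; setoid; *-assoc; *-comm; *-identityˡ; *-identityʳ; *-cong; *-congˡ; *-congʳ;
           *-commutativeSemigroup)
    renaming (refl to ≈-refl; sym to ≈-sym; trans to ≈-trans; reflexive to ≈-reflexive)
  open Twisted K ξ ξ⁻¹ using (_^_; pw; IsRootOfUnity)
  open CommSemigroupProperties *-commutativeSemigroup using (interchange; xy∙z≈xz∙y)
  open import Relation.Binary.Reasoning.Setoid setoid

  ^-+ : ∀ x a b → x ^ (a ℕ.+ b) ≈ x ^ a * x ^ b
  ^-+ x zero b = ≈-sym (*-identityˡ _)
  ^-+ x (suc a) b = ≈-trans (*-congˡ (^-+ x a b)) (≈-sym (*-assoc _ _ _))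

  quotient : ℕ → ℕ → Carrier
  quotient a b = ξ ^ a * ξ⁻¹ ^ b

  quotient-suc : ∀ a b → quotient (suc a) (suc b) ≈ quotient a b
  quotient-suc a b = begin
      (ξ * ξ ^ a) * (ξ⁻¹ * ξ⁻¹ ^ b)   ≈⟨ interchange ξ (ξ ^ a) ξ⁻¹ (ξ⁻¹ ^ b) ⟩
      (ξ * ξ⁻¹) * quotient a b         ≈⟨ *-congʳ ξξ⁻¹≈1 ⟩
      1# * quotient a b                ≈⟨ *-identityˡ _ ⟩
      quotient a b                     ∎

  pw-⊖ : ∀ a b → pw (a ⊖ b) ≈ quotient a b
  pw-⊖ a zero = ≈-sym (*-identityʳ _)
  pw-⊖ zero (suc b) = ≈-sym (*-identityˡ _)
  pw-⊖ (suc a) (suc b) rewrite ℤP.[1+m]⊖[1+n]≡m⊖n a b = ≈-trans (pw-⊖ a b) (≈-sym (quotient-suc a b))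

  plus minus : ℤ → ℕ
  plus (+ k) = k
  plus -[1+ k ] = 0
  minus (+ k) = 0
  minus -[1+ k ] = suc k

  plus⊖minus : ∀ z → plus z ⊖ minus z ≡ z
  plus⊖minus (+ k) = refl
  plus⊖minus -[1+ k ] = refl

  pw-quotient : ∀ z → pw z ≈ quotient (plus z) (minus z)
  pw-quotient z = subst (λ w → pw w ≈ quotient (plus z) (minus z)) (plus⊖minus z) (pw-⊖ (plus z) (minus z))

  pw-hom : ∀ x y → pw (x ℤ.+ y) ≈ pw x * pw y
  pw-hom x (+ k) = begin
      pw (x ℤ.+ + k)
    ≡⟨ cong (λ w → pw (w ℤ.+ + k)) (plus⊖minus x) ⟨
      pw ((plus x ⊖ minus x) ℤ.+ + k)
    ≡⟨ cong pw (ℤP.distribˡ-⊖-+-pos k (plus x) (minus x)) ⟩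
      pw ((plus x ℕ.+ k) ⊖ minus x)
    ≈⟨ pw-⊖ (plus x ℕ.+ k) (minus x) ⟩
      ξ ^ (plus x ℕ.+ k) * ξ⁻¹ ^ minus x
    ≈⟨ *-congʳ (^-+ ξ (plus x) k) ⟩
      (ξ ^ plus x * ξ ^ k) * ξ⁻¹ ^ minus x
    ≈⟨ xy∙z≈xz∙y (ξ ^ plus x) (ξ ^ k) (ξ⁻¹ ^ minus x) ⟩
      quotient (plus x) (minus x) * ξ ^ k
    ≈⟨ *-congʳ (pw-quotient x) ⟨
      pw x * pw (+ k) ∎
  pw-hom x -[1+ k ] = begin
      pw (x ℤ.+ -[1+ k ])
    ≡⟨ cong (λ w → pw (w ℤ.+ -[1+ k ])) (plus⊖minus x) ⟨
      pw ((plus x ⊖ minus x) ℤ.+ -[1+ k ])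
    ≡⟨ cong pw (ℤP.distribˡ-⊖-+-neg k (plus x) (minus x)) ⟩
      pw (plus x ⊖ (suc (minus x) ℕ.+ k))
    ≡⟨ cong (λ w → pw (plus x ⊖ w)) (+-suc (minus x) k) ⟨
      pw (plus x ⊖ (minus x ℕ.+ suc k))
    ≈⟨ pw-⊖ (plus x) (minus x ℕ.+ suc k) ⟩
      ξ ^ plus x * ξ⁻¹ ^ (minus x ℕ.+ suc k)
    ≈⟨ *-congˡ (^-+ ξ⁻¹ (minus x) (suc k)) ⟩
      ξ ^ plus x * (ξ⁻¹ ^ minus x * ξ⁻¹ ^ suc k)
    ≈⟨ *-assoc _ _ _ ⟨
      quotient (plus x) (minus x) * ξ⁻¹ ^ suc k
    ≈⟨ *-congʳ (pw-quotient x) ⟨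
      pw x * pw -[1+ k ] ∎

  pw-inverse : ∀ z → pw z * pw (- z) ≈ 1#
  pw-inverse z = ≈-trans (≈-sym (pw-hom z (- z))) (≈-reflexive (cong pw (ℤP.+-inverseʳ z)))

  pw-inverse′ : ∀ z → pw (- z) * pw z ≈ 1#
  pw-inverse′ z = ≈-trans (*-comm _ _) (pw-inverse z)

  pw-≈-neg : ∀ i j → pw i ≈ pw (- j) ⇔ pw (i ℤ.+ j) ≈ 1#
  pw-≈-neg i j = mk⇔ to from
    where
    to : pw i ≈ pw (- j) → pw (i ℤ.+ j) ≈ 1#
    to h = begin
      pw (i ℤ.+ j)     ≈⟨ pw-hom i j ⟩
      pw i * pw j      ≈⟨ *-congʳ h ⟩
      pw (- j) * pw j  ≈⟨ pw-inverse′ j ⟩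
      1#               ∎
    from : pw (i ℤ.+ j) ≈ 1# → pw i ≈ pw (- j)
    from h = begin
      pw i                        ≈⟨ *-identityʳ _ ⟨
      pw i * 1#                   ≈⟨ *-congˡ (pw-inverse j) ⟨
      pw i * (pw j * pw (- j))    ≈⟨ *-assoc _ _ _ ⟨
      (pw i * pw j) * pw (- j)    ≈⟨ *-congʳ (pw-hom i j) ⟨
      pw (i ℤ.+ j) * pw (- j)     ≈⟨ *-congʳ h ⟩
      1# * pw (- j)               ≈⟨ *-identityˡ _ ⟩
      pw (- j)                    ∎

  pw-cancel : ∀ i x → pw i * x ≈ pw i → x ≈ 1#
  pw-cancel i x h = begin
    x                          ≈⟨ *-identityˡ x ⟨
    1# * x                     ≈⟨ *-congʳ (pw-inverse′ i) ⟨
    (pw (- i) * pw i) * x      ≈⟨ *-assoc _ _ _ ⟩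
    pw (- i) * (pw i * x)      ≈⟨ *-congˡ h ⟩
    pw (- i) * pw i            ≈⟨ pw-inverse′ i ⟩
    1#                         ∎

  idempotent-exponent : ∀ i m → pw (i ℤ.+ i ℤ.+ + m) ≈ pw i ⇔ pw i ≈ pw (- + m)
  idempotent-exponent i m = mk⇔
    (λ h → Equivalence.from (pw-≈-neg i (+ m)) (pw-cancel i _ (≈-trans (≈-sym split) h)))
    (λ h → ≈-trans split (≈-trans (*-congˡ (Equivalence.to (pw-≈-neg i (+ m)) h)) (*-identityʳ _)))
    where
    split : pw (i ℤ.+ i ℤ.+ + m) ≈ pw i * pw (i ℤ.+ + m)
    split = ≈-trans (≈-reflexive (cong pw (ℤP.+-assoc i i (+ m)))) (pw-hom i (i ℤ.+ + m))

  root-power : ∀ r → ξ ^ r ≈ 1# → ∀ m → ξ ^ (r ℕ.* m) ≈ 1#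
  root-power r h zero = ≈-reflexive (cong (ξ ^_) (*-zeroʳ r))
  root-power r h (suc m) = begin
    ξ ^ (r ℕ.* suc m)          ≡⟨ cong (ξ ^_) (*-suc r m) ⟩
    ξ ^ (r ℕ.+ r ℕ.* m)        ≈⟨ ^-+ ξ r (r ℕ.* m) ⟩
    ξ ^ r * ξ ^ (r ℕ.* m)      ≈⟨ *-cong h (root-power r h m) ⟩
    1# * 1#                    ≈⟨ *-identityˡ _ ⟩
    1#                         ∎

  not-root : ¬ IsRootOfUnity → ∀ k → ξ ^ k ≈ 1# → k ≡ 0
  not-root nr zero h = refl
  not-root nr (suc k) h = ⊥-elim (nr (suc k , s≤s z≤n , h))

module TwistedVariant {c ℓ} (K : CommutativeRing c ℓ) (ξ ξ⁻¹ : CommutativeRing.Carrier K)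
  (ξξ⁻¹≈1 : CommutativeRing._≈_ K (CommutativeRing._*_ K ξ ξ⁻¹) (CommutativeRing.1# K))
  (k : Kind) (n : ℕ) where
  open CommutativeRing K using (_≈_) renaming (sym to ≈-sym; trans to ≈-trans; refl to ≈-refl)
  open Twisted K ξ ξ⁻¹
  open IntegerPowers K ξ ξ⁻¹ ξξ⁻¹≈1

  generated-in-S : ∀ {y} → Gen k {n} y → InS k (proj₂ y)
  generated-in-S (gen α s) = s
  generated-in-S (mul g h) = closure k (generated-in-S g) (generated-in-S h)

  generated-exponent : ∀ {y} → Gen k {n} y → Σ ℕ λ j → proj₁ y ≡ + j
  generated-exponent (gen α s) = 0 , refl
  generated-exponent (mul g h) with generated-exponent g | generated-exponent h
  ... | (a , ea) | (b , eb) rewrite ea | eb = _ , refl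

  idempotent⇔ : ∀ i (α : Table n) → IsIdem (i , α) ⇔ ((α · α ≡ α) × pw i ≈ pw (- + m α α))
  idempotent⇔ i α = mk⇔
    (λ (e , h) → e , Equivalence.to (idempotent-exponent i (m α α)) h)
    (λ (e , h) → e , Equivalence.from (idempotent-exponent i (m α α)) h)

  E-to-EZ : ∀ (α : Table n) → InS k α → (InES k α ⇔ InEZ k (- + m α α , α))
  E-to-EZ α _ = mk⇔ (λ (s , e) → s , Equivalence.from (idempotent⇔ (- + m α α) α) (e , ≈-refl))
                    (λ (s , idem) → s , proj₁ idem)

  EZ-covered : ∀ (x : Elem n) → InEZ k x → Σ (Table n) λ α → InES k α × (x ≋ (- + m α α , α))
  EZ-covered (i , α) (s , idem) with Equivalence.to (idempotent⇔ i α) idem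
  ... | (e , h) = α , (s , e) , (refl , h)

  -- (ii): for ξ^(1+r) = 1 the exponent -m can be replaced by the natural number r m
  module RootOfUnity (r : ℕ) (root : ξ ^ suc r ≈ CommutativeRing.1# K) where

    exponent : Table n → ℕ
    exponent α = r ℕ.* m α α

    exponent≈ : ∀ α → pw (+ exponent α) ≈ pw (- + m α α)
    exponent≈ α = Equivalence.from (pw-≈-neg (+ exponent α) (+ m α α))
      (subst (λ e → ξ ^ e ≈ CommutativeRing.1# K) (+-comm (m α α) (exponent α)) (root-power (suc r) root (m α α)))

    to : Σ (Table n) (InES k) → ENCarrier k
    to (α , (s , e)) = (+ exponent α , α) ,
      ((s , (exponent α , ≋-refl (+ exponent α , α))) ,
       Equivalence.from (idempotent⇔ (+ exponent α) α) (e , exponent≈ α))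

    bijection : Bijection (ES-setoid k {n}) (EN-setoid k {n})
    bijection = record
      { to = to
      ; cong = λ { {α , _} refl → ≋-refl (+ exponent α , α) }
      ; bijective = proj₁ , surjective
      }
      where
      surjective : ∀ y → Σ (Σ (Table n) (InES k)) λ x →
                   ∀ {z} → proj₁ z ≡ proj₁ x → proj₁ (to z) ≋ proj₁ y
      surjective ((i , β) , ((s , _) , idem)) with Equivalence.to (idempotent⇔ i β) idem
      ... | (e , h) = (β , (s , e)) , λ { {β , _} refl → refl , ≈-trans (exponent≈ β) (≈-sym h) }

  root-bijection : IsRootOfUnity → Bijection (ES-setoid k {n}) (EN-setoid k {n})
  root-bijection (suc r , _ , root) = RootOfUnity.bijection r root

  natural-exponent : ¬ IsRootOfUnity → ∀ j mm → pw (+ j) ≈ pw (- + mm) → (j ≡ 0) × (mm ≡ 0)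
  natural-exponent nr j mm h with not-root nr (j ℕ.+ mm) (Equivalence.to (pw-≈-neg (+ j) (+ mm)) h)
  ... | e = m+n≡0⇒m≡0 j e , m+n≡0⇒n≡0 j e

  EN-to-ESξ : ¬ IsRootOfUnity → ∀ x → InEN k x → InESξ k x
  EN-to-ESξ nr (i , α) ((s , (j , (_ , ξ^i≈ξ^j))) , idem)
    with natural-exponent nr j (m α α)
           (≈-trans (≈-sym ξ^i≈ξ^j) (proj₂ (Equivalence.to (idempotent⇔ i α) idem)))
  ... | (refl , _) = ((+ 0 , α) , gen α s , (refl , ≈-sym ξ^i≈ξ^j)) , idem

  ESξ-to-EN : ∀ x → InESξ k x → InEN k x
  ESξ-to-EN x ((y , g , (refl , ξ^y≈ξ^x)) , idem) with generated-exponent g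
  ... | (j , refl) = (generated-in-S g , (j , (refl , ≈-sym ξ^y≈ξ^x))) , idem

  ESξ-to-E₀ : ¬ IsRootOfUnity → ∀ x → InESξ k x →
              Σ (Table n) λ α → InES k α × (m α α ≡ 0) × (x ≋ (+ 0 , α))
  ESξ-to-E₀ nr (i , α) ((y , g , (refl , ξ^y≈ξ^i)) , idem) with generated-exponent g
  ... | (j , refl) with Equivalence.to (idempotent⇔ i α) idem
  ...   | (e , h) with natural-exponent nr j (m α α) (≈-trans ξ^y≈ξ^i h)
  ...     | (refl , m≡0) = α , (generated-in-S g , e) , m≡0 , (refl , ≈-sym ξ^y≈ξ^i)

  E₀-to-ESξ : ∀ x → (Σ (Table n) λ α → InES k α × (m α α ≡ 0) × (x ≋ (+ 0 , α))) → InESξ k x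
  E₀-to-ESξ (i , α) (_ , (s , e) , m≡0 , (refl , ξ^i≈1)) =
    ((+ 0 , α) , gen α s , (refl , ≈-sym ξ^i≈1)) ,
    Equivalence.from (idempotent⇔ i α) (e , subst (λ mm → pw i ≈ pw (- + mm)) (sym m≡0) ξ^i≈1)

  not-root-idempotents : ¬ IsRootOfUnity → ∀ (x : Elem n) →
    (InEN k x ⇔ InESξ k x) × (InESξ k x ⇔ Σ (Table n) λ α → InES k α × (m α α ≡ 0) × (x ≋ (+ 0 , α)))
  not-root-idempotents nr x = mk⇔ (EN-to-ESξ nr x) (ESξ-to-EN x) , mk⇔ (ESξ-to-E₀ nr x) (E₀-to-ESξ x)

proposition4p4 :
    ∀ {c ℓ} (K : CommutativeRing c ℓ) → IsField K →
    (ξ ξ⁻¹ : CommutativeRing.Carrier K) →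
    CommutativeRing._≈_ K (CommutativeRing._*_ K ξ ξ⁻¹) (CommutativeRing.1# K) →
    (k : Kind) (n : ℕ) →
    let open Twisted K ξ ξ⁻¹ in
    -- (i) α ↦ ξ^(-m(α,α)) α is a bijection E(S) → E(⟨S^ξ, ξ1, ξ⁻¹1⟩)
    ( (∀ (α : Table n) → InS k α →
         (InES k α ⇔ InEZ k (- (+ m α α) , α)))
      × (∀ (α β : Table n) → InES k α → InES k β →
           (- (+ m α α) , α) ≋ (- (+ m β β) , β) → α ≡ β)
      × (∀ (x : Elem n) → InEZ k x →
           Σ (Table n) λ α → InES k α × (x ≋ (- (+ m α α) , α))) )
    -- (ii) ξ a root of unity ⇒ |E(⟨S^ξ, ξ1⟩)| = |E(S)|
    × (IsRootOfUnity → Bijection (ES-setoid k {n}) (EN-setoid k {n}))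
    -- (iii) ξ not a root of unity ⇒ E(⟨S^ξ, ξ1⟩) = E(S^ξ) = {α ∈ E(S) : m(α,α) = 0}
    × (¬ IsRootOfUnity → ∀ (x : Elem n) →
         (InEN k x ⇔ InESξ k x)
         × (InESξ k x ⇔ Σ (Table n) λ α → InES k α × (m α α ≡ 0) × (x ≋ (+ 0 , α))))
proposition4p4 K _ ξ ξ⁻¹ ξξ⁻¹≈1 k n =
  (E-to-EZ , (λ α β _ _ → proj₁) , EZ-covered) , root-bijection , not-root-idempotents
  where open TwistedVariant K ξ ξ⁻¹ ξξ⁻¹≈1 k n
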